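{- Let $w$ be a prefix-shuffle and let $c$ be the corner of the prefix-map $M_w$ at the left of the last rooting head of $M_w$. Then: (i) $M_{wa}$ is obtained from $M_w$ by adding an edge $e$ in the corner $c$, oriented from this corner to a vertex not present in $M_w$; $e$ is the last active edge of $M_{wa}$. (ii) $M_{wb}$ is obtained from $M_w$ by adding a dangling head $h$ in the corner $c$; $h$ is the last dangling head of $M_{wb}$. (iii) $M_{w\bar a}$ is obtained from $M_w$ by inactivating the last active edge $e$; the origin of $e$ becomes the last rooting vertex. (iv) $M_{w\bar b}$ is obtained from $M_w$ by adding a tail in the corner $c$ and connecting it to the last dangling head. In each case, the order of appearance on the edges, half-edges and vertices present in $M_w$ is the same in $M_{w\alpha}$.
   Context: A prefix-shuffle is a word $w$ on $\{a,\bar a,b,\bar b\}$ such that every prefix $w'$ satisfies $|w'|_a\ge|w'|_{\bar a}$ and $|w'|_b\ge|w'|_{\bar b}$. Let $w_a$ (resp. $w_b$) be the subword of letters in $\{a,\bar a\}$ (resp. $\{b,\bar b\}$); an occurrence of $c\in\{a,b\}$ is paired with an occurrence of $\bar c$ if the subword of $w_c$ strictly between them is a parenthesis system (a word with equally many $c,\bar c$ and every prefix having at least as many $c$ as $\bar c$). Let $w_a^+$ be $w_a$ followed by $|w|_a-|w|_{\bar a}$ letters $\bar a$. Let $T_w$ be the planted plane tree whose tour (following its border counterclockwise from the root, writing $a$ the first time an edge is followed and $\bar a$ the second time) gives $w_a^+$; orient its edges away from the root-vertex. The prefix-map $M_w$ is obtained by reading $w$ while touring $T_w$ according to the letters $a,\bar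 a$, inserting at the current corner a head for each letter $b$ and a tail for each letter $\bar b$, and connecting the head and tail of each paired occurrences $b,\bar b$; the heads of unpaired letters $b$ are dangling heads. Edges of $T_w$ corresponding to unpaired letters $a$ are active, the others inactive. The heads of active edges, together with the root, are rooting heads; their ends are rooting vertices. Edges, half-edges, vertices, rooting heads and dangling heads are compared by order of appearance around $T_w$, the root being the first rooting head. A corner is the region between two consecutive half-edges around a vertex. -}

module Defs where

open import Data.Nat using (ℕ; zero; suc; _+_; _∸_; _≤_; _<_; _≟_)
open import Data.Bool using (Bool; true; false; if_then_else_)
open import Data.List using (List; []; _∷_; _++_; take; drop; length; replicate)
open import Data.Maybe using (Maybe; just; nothing)
open import Data.Product using (Σ; ∃; ∃-syntax; _×_; _,_)
open import Data.Sum using (_⊎_)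
open import Relation.Nullary using (¬_; yes; no)
open import Relation.Binary.PropositionalEquality using (_≡_; _≢_)

data Letter : Set where
  a ā b b̄ : Letter

eqL : Letter → Letter → Bool
eqL a a = true
eqL ā ā = true
eqL b b = true
eqL b̄ b̄ = true
eqL _ _ = false

count : Letter → List Letter → ℕ
count x [] = 0
count x (y ∷ ys) = if eqL x y then suc (count x ys) else count x ys

PrefixShuffle : List Letter → Set
PrefixShuffle w = ∀ n → count ā (take n w) ≤ count a (take n w)
                      × count b̄ (take n w) ≤ count b (take n w)

data Fam : Set where
  A B : Fam

opn cls : Fam → Letter
opn A = a
opn B = b
cls A = ā
cls B = b̄

inFam : Fam → Letter → Bool
inFam A a = true
inFam A ā = true
inFam B b = true
inFam B b̄ = true
inFam _ _ = false

sub : Fam → List Letter → List Letter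
sub F [] = []
sub F (x ∷ xs) = if inFam F x then x ∷ sub F xs else sub F xs

ParenSys : Fam → List Letter → Set
ParenSys F u = count (opn F) u ≡ count (cls F) u
             × (∀ n → count (cls F) (take n u) ≤ count (opn F) (take n u))

_at_ : {X : Set} → List X → ℕ → Maybe X
[] at _ = nothing
(x ∷ xs) at zero = just x
(x ∷ xs) at suc i = xs at i

between : ℕ → ℕ → List Letter → List Letter
between i j w = take (j ∸ suc i) (drop (suc i) w)

Paired : Fam → List Letter → ℕ → ℕ → Set
Paired F w i j = i < j × w at i ≡ just (opn F) × w at j ≡ just (cls F)
               × ParenSys F (sub F (between i j w))

-- A (prefix-)map is presented by the sequence of events met while
-- touring the spanning tree T counterclockwise from the root:
--   down i : an edge of T followed for the first time (edge named i),
--   up     : an edge of T followed for the second time,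
--   hd j   : a head (named j) inserted at the current corner,
--   tl j   : a tail (named j) inserted at the current corner.
-- The corners of the map are the gaps 0 .. length of this sequence
-- (gap g lies just before step g; gap 0 is right after the root and the
-- last gap right before it).

data Step : Set where
  down : ℕ → Step
  up   : Step
  hd   : ℕ → Step
  tl   : ℕ → Step

record PMap : Set₁ where
  field
    contour : List Step
    Active  : ℕ → Set
    Link    : ℕ → ℕ → Set
open PMap public

insertAt : ℕ → List Step → List Step → List Step
insertAt g ys xs = take g xs ++ ys ++ drop g xs

-- The prefix-map M_w
-- (names: the object created by the letter at position p is named p)

stepOf : ℕ → Letter → Step
stepOf p a = down p
stepOf p ā = up
stepOf p b = hd p
stepOf p b̄ = tl p

steps : ℕ → List Letter → List Step
steps p [] = []
steps p (x ∷ xs) = stepOf p x ∷ steps (suc p) xs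

-- reading w while touring T_w, whose tour is w_a^+
M : List Letter → PMap
M w = record
  { contour = steps 0 w ++ replicate (count a w ∸ count ā w) up
  ; Active  = λ i → w at i ≡ just a × ¬ (∃[ j ] Paired A w i j)
  ; Link    = λ h t → Paired B w h t
  }

data Kind : Set where
  vK hK eK : Kind

data Item : Kind → Set where
  rootV    : Item vK
  childV   : ℕ → Item vK      -- end vertex of tree edge i
  rootH    : Item hK
  treeTail : ℕ → Item hK
  treeHead : ℕ → Item hK
  headH    : ℕ → Item hK
  tailH    : ℕ → Item hK
  treeE    : ℕ → Item eK
  linkE    : ℕ → Item eK      -- non-tree edge whose head is h

stepEvents : Step → List (Σ Kind Item)
stepEvents (down i) = (hK , treeTail i) ∷ (eK , treeE i) ∷ (hK , treeHead i) ∷ (vK , childV i) ∷ []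
stepEvents up = []
stepEvents (hd j) = (hK , headH j) ∷ []
stepEvents (tl j) = (hK , tailH j) ∷ []

concatEv : List Step → List (Σ Kind Item)
concatEv [] = []
concatEv (s ∷ ss) = stepEvents s ++ concatEv ss

events : PMap → List (Σ Kind Item)
events m = (vK , rootV) ∷ (hK , rootH) ∷ concatEv (contour m)

Occ : (m : PMap) → {k : Kind} → Item k → ℕ → Set
Occ m (linkE h) n = (events m at n ≡ just (hK , headH h) × ∃[ t ] Link m h t)
                  ⊎ (∃[ t ] (events m at n ≡ just (hK , tailH t) × Link m h t))
Occ m {k} x n = events m at n ≡ just (k , x)

Present : (m : PMap) → {k : Kind} → Item k → Set
Present m x = ∃[ n ] Occ m x n

FirstOcc : (m : PMap) → {k : Kind} → Item k → ℕ → Set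
FirstOcc m x n = Occ m x n × (∀ n' → Occ m x n' → n ≤ n')

Before : (m : PMap) → {k : Kind} → Item k → Item k → Set
Before m x y = ∃[ n ] ∃[ n' ] (FirstOcc m x n × FirstOcc m y n' × n < n')

ActiveEdge : PMap → ℕ → Set
ActiveEdge m i = Active m i × Present m (treeE i)

LastActiveEdge : PMap → ℕ → Set
LastActiveEdge m e = ActiveEdge m e
  × (∀ i → ActiveEdge m i → i ≢ e → Before m (treeE i) (treeE e))

Dangling : PMap → ℕ → Set
Dangling m h = Present m (headH h) × ¬ (∃[ t ] Link m h t)

LastDangling : PMap → ℕ → Set
LastDangling m h = Dangling m h
  × (∀ h' → Dangling m h' → h' ≢ h → Before m (headH h') (headH h))

RootingHead : PMap → Item hK → Set
RootingHead m h = h ≡ rootH ⊎ ∃[ i ] (h ≡ treeHead i × ActiveEdge m i)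

LastRootingHead : PMap → Item hK → Set
LastRootingHead m h = RootingHead m h
  × (∀ h' → RootingHead m h' → h' ≢ h → Before m h' h)

data End : Item hK → Item vK → Set where
  end-root : End rootH rootV
  end-tree : ∀ {i} → End (treeHead i) (childV i)

RootingVertex : PMap → Item vK → Set
RootingVertex m v = ∃[ h ] (RootingHead m h × End h v)

LastRootingVertex : PMap → Item vK → Set
LastRootingVertex m v = RootingVertex m v
  × (∀ u → RootingVertex m u → u ≢ v → Before m u v)

-- index of the step `up` closing the tree edge opened just before
matchFrom : ℕ → ℕ → List Step → Maybe ℕ
matchFrom d k [] = nothing
matchFrom d k (down _ ∷ xs) = matchFrom (suc d) (suc k) xs
matchFrom zero k (up ∷ xs) = just k
matchFrom (suc d) k (up ∷ xs) = matchFrom d (suc k) xs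
matchFrom d k (hd _ ∷ xs) = matchFrom d (suc k) xs
matchFrom d k (tl _ ∷ xs) = matchFrom d (suc k) xs

matchUp : ℕ → List Step → Maybe ℕ
matchUp i = go 0
  where
  go : ℕ → List Step → Maybe ℕ
  go k [] = nothing
  go k (down j ∷ xs) with j ≟ i
  ... | yes _ = matchFrom 0 (suc k) xs
  ... | no  _ = go (suc k) xs
  go k (up ∷ xs) = go (suc k) xs
  go k (hd _ ∷ xs) = go (suc k) xs
  go k (tl _ ∷ xs) = go (suc k) xs

-- corner at the left of a head of the tree: for the root it is the last
-- corner of the tour; for the head of tree edge i (at its end vertex) it
-- is the corner just before the edge i is followed for the second time
data LeftCorner (m : PMap) : Item hK → ℕ → Set where
  lc-root : LeftCorner m rootH (length (contour m))
  lc-tree : ∀ {i g} → matchUp i (contour m) ≡ just g → LeftCorner m (treeHead i) g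

CornerLeftOfLastRootingHead : PMap → ℕ → Set
CornerLeftOfLastRootingHead m c = ∃[ h ] (LastRootingHead m h × LeftCorner m h c)

-- vertex of the corner at gap g (stack walk along the tour)
pop : List (Item vK) → List (Item vK)
pop (x ∷ y ∷ ys) = y ∷ ys
pop s = s

walk : List Step → List (Item vK) → List (Item vK)
walk [] s = s
walk (down i ∷ xs) s = walk xs (childV i ∷ s)
walk (up ∷ xs) s = walk xs (pop s)
walk (hd _ ∷ xs) s = walk xs s
walk (tl _ ∷ xs) s = walk xs s

top : List (Item vK) → Item vK
top [] = rootV
top (x ∷ _) = x

cornerVertex : List Step → ℕ → Item vK
cornerVertex xs g = top (walk (take g xs) (rootV ∷ []))

Origin : PMap → ℕ → Item vK → Set
Origin m e v = ∃[ s ] (contour m at s ≡ just (down e) × cornerVertex (contour m) s ≡ v)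

_iff_ : Set → Set → Set
P iff Q = (P → Q) × (Q → P)

SameActive : PMap → PMap → Set
SameActive m m' = ∀ i → Active m i iff Active m' i

SameLinks : PMap → PMap → Set
SameLinks m m' = ∀ h t → Link m h t iff Link m' h t

SameOrder : PMap → PMap → Set
SameOrder m m' = ∀ {k} (x y : Item k) → Present m x → Present m y
               → Before m x y iff Before m' x y

{-# OPTIONS --safe #-}
-- Read w from left to right keeping, for each family, the height (the number of
-- unmatched openers so far): a closing letter pairs with the last unmatched opener, so
-- the active edges are the unmatched letters a. The tour of T_w is the sequence of steps
-- of w followed by one ā-step per unmatched a; hence the last rooting head is the head
-- of the last unmatched a (or the root if there is none), and the corner at its left is
-- the gap right after the steps of w. Appending a letter therefore inserts its steps at
-- that corner, and its events come after all events of M_w in the tour, which keeps the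
-- order of appearance. A new ā or b̄ pairs with the last unmatched opener; when an ā
-- closes the last unmatched a, its origin is the end vertex of the previous unmatched a,
-- or the root if there is none, and that becomes the last rooting vertex.
module Submission where

open import Defs
open import Data.Nat using (ℕ; zero; suc; pred; _+_; _*_; _∸_; _≤_; _<_; z≤n; s≤s; _≟_; _<?_)
open import Data.Nat.Properties
open import Data.List using (List; []; _∷_; _++_; _∷ʳ_; take; drop; length; replicate)
open import Data.List.Properties using (++-assoc; ++-identityʳ; length-++; length-replicate; length-take; length-drop; take++drop≡id; take-drop; drop-drop)
open import Data.List.Reverse using (Reverse; []; _∶_∶ʳ_; reverseView)
open import Data.Maybe using (Maybe; just; nothing)
import Data.Maybe as Maybe
open import Data.Maybe.Properties using (just-injective; map-id; map-∘)
open import Data.Product using (Σ; ∃-syntax; _×_; _,_; proj₁; proj₂)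
open import Data.Sum using (_⊎_; inj₁; inj₂; [_,_]′)
open import Data.Empty using (⊥; ⊥-elim)
open import Data.Unit using (⊤; tt)
open import Function using (_∘_; id)
open import Relation.Nullary using (¬_; Dec; yes; no)
open import Relation.Binary.PropositionalEquality
open import Relation.Binary.Definitions using (tri<; tri≈; tri>)

module _ {X : Set} where

  at⇒< : ∀ (xs : List X) p {x} → xs at p ≡ just x → p < length xs
  at⇒< (_ ∷ _) zero _ = s≤s z≤n
  at⇒< (_ ∷ xs) (suc p) e = s≤s (at⇒< xs p e)

  at-++ˡ : ∀ (xs ys : List X) {p} → p < length xs → (xs ++ ys) at p ≡ xs at p
  at-++ˡ (_ ∷ _) ys {zero} _ = refl
  at-++ˡ (_ ∷ xs) ys {suc p} (s≤s p<) = at-++ˡ xs ys p<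

  at-++ʳ : ∀ (xs ys : List X) {p} → length xs ≤ p → (xs ++ ys) at p ≡ ys at (p ∸ length xs)
  at-++ʳ [] ys _ = refl
  at-++ʳ (_ ∷ xs) ys {suc p} (s≤s ≤p) = at-++ʳ xs ys ≤p

  at-++-length : ∀ (xs ys : List X) p → (xs ++ ys) at (length xs + p) ≡ ys at p
  at-++-length [] ys p = refl
  at-++-length (_ ∷ xs) ys p = at-++-length xs ys p

  at-++⁻ : ∀ (xs ys : List X) p {z} → (xs ++ ys) at p ≡ just z
         → xs at p ≡ just z ⊎ (length xs ≤ p × ys at (p ∸ length xs) ≡ just z)
  at-++⁻ xs ys p e with p <? length xs
  ... | yes p< = inj₁ (trans (sym (at-++ˡ xs ys p<)) e)
  ... | no p≮ = inj₂ (≮⇒≥ p≮ , trans (sym (at-++ʳ xs ys (≮⇒≥ p≮))) e)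

  at-drop : ∀ (xs : List X) k p → drop k xs at p ≡ xs at (k + p)
  at-drop xs zero p = refl
  at-drop [] (suc k) p = refl
  at-drop (_ ∷ xs) (suc k) p = at-drop xs k p

  at-drop-∸ : ∀ (xs : List X) {k p} → k ≤ p → drop k xs at (p ∸ k) ≡ xs at p
  at-drop-∸ xs {k} k≤p = trans (at-drop xs k _) (cong (xs at_) (m+[n∸m]≡n k≤p))

  at-take : ∀ (xs : List X) {k p} → p < k → take k xs at p ≡ xs at p
  at-take [] {suc k} _ = refl
  at-take (_ ∷ _) {suc k} {zero} _ = refl
  at-take (_ ∷ xs) {suc k} {suc p} (s≤s p<) = at-take xs p<

  at⇒take-∷-drop : ∀ (xs : List X) k {x} → xs at k ≡ just x → xs ≡ take k xs ++ x ∷ drop (suc k) xs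
  at⇒take-∷-drop (_ ∷ _) zero refl = refl
  at⇒take-∷-drop (y ∷ xs) (suc k) e = cong (y ∷_) (at⇒take-∷-drop xs k e)

  length-take-≤ : ∀ (xs : List X) {k} → k ≤ length xs → length (take k xs) ≡ k
  length-take-≤ xs {k} k≤ = trans (length-take k xs) (m≤n⇒m⊓n≡m k≤)

  at-∷ʳ-length : ∀ (xs : List X) x → (xs ∷ʳ x) at length xs ≡ just x
  at-∷ʳ-length [] x = refl
  at-∷ʳ-length (_ ∷ xs) x = at-∷ʳ-length xs x

  at-∷ʳ-≢ : ∀ (xs : List X) x {p} → p ≢ length xs → (xs ∷ʳ x) at p ≡ xs at p
  at-∷ʳ-≢ [] x {zero} p≢ = ⊥-elim (p≢ refl)
  at-∷ʳ-≢ [] x {suc p} p≢ = refl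
  at-∷ʳ-≢ (_ ∷ xs) x {zero} p≢ = refl
  at-∷ʳ-≢ (_ ∷ xs) x {suc p} p≢ = at-∷ʳ-≢ xs x (p≢ ∘ cong suc)

  at-∷ʳ⇒≤ : ∀ (xs : List X) x {p y} → (xs ∷ʳ x) at p ≡ just y → p ≤ length xs
  at-∷ʳ⇒≤ xs x {p} e = ≤-pred (subst (p <_) (trans (length-++ xs) (+-comm (length xs) 1)) (at⇒< (xs ∷ʳ x) p e))

  drop-++ˡ : ∀ (xs ys : List X) {k} → k ≤ length xs → drop k (xs ++ ys) ≡ drop k xs ++ ys
  drop-++ˡ xs ys {zero} _ = refl
  drop-++ˡ (_ ∷ xs) ys {suc k} (s≤s k≤) = drop-++ˡ xs ys k≤

  drop-suc-length : ∀ (xs : List X) x → drop (suc (length xs)) (xs ∷ʳ x) ≡ []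
  drop-suc-length [] x = refl
  drop-suc-length (_ ∷ xs) x = drop-suc-length xs x

  drop-drop-suc : ∀ (xs : List X) e q → drop (suc q) (drop (suc e) xs) ≡ drop (suc (suc e + q)) xs
  drop-drop-suc xs e q = trans (drop-drop (suc e) (suc q) xs) (cong (λ n → drop n xs) (+-suc (suc e) q))

  drop-take-++ : ∀ (xs : List X) {k r} → k ≤ r → drop k (take r xs) ++ drop r xs ≡ drop k xs
  drop-take-++ xs {zero} {r} _ = take++drop≡id r xs
  drop-take-++ [] {suc k} {suc r} _ = refl
  drop-take-++ (_ ∷ xs) {suc k} {suc r} (s≤s k≤r) = drop-take-++ xs k≤r

  take-++-length : ∀ (xs ys : List X) → take (length xs) (xs ++ ys) ≡ xs
  take-++-length [] ys = refl
  take-++-length (x ∷ xs) ys = cong (x ∷_) (take-++-length xs ys)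

swap-iff : ∀ {P Q : Set} → P iff Q → Q iff P
swap-iff (f , g) = g , f

data Role : Set where
  opener closer other : Role

role : Fam → Letter → Role
role A a = opener
role A ā = closer
role B b = opener
role B b̄ = closer
role _ _ = other

role-opn : ∀ F → role F (opn F) ≡ opener
role-opn A = refl
role-opn B = refl

role-cls : ∀ F → role F (cls F) ≡ closer
role-cls A = refl
role-cls B = refl

role≡opener : ∀ F x → role F x ≡ opener → x ≡ opn F
role≡opener A a _ = refl
role≡opener B b _ = refl
role≡opener A ā ()
role≡opener A b ()
role≡opener A b̄ ()
role≡opener B a ()
role≡opener B ā ()
role≡opener B b̄ ()

role≡closer : ∀ F x → role F x ≡ closer → x ≡ cls F
role≡closer A ā _ = refl
role≡closer B b̄ _ = refl
role≡closer A a ()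
role≡closer A b ()
role≡closer A b̄ ()
role≡closer B a ()
role≡closer B ā ()
role≡closer B b ()

raise : Role → ℕ → ℕ
raise opener d = suc d
raise closer d = pred d
raise other d = d

Safe : Role → ℕ → Set
Safe closer zero = ⊥
Safe _ _ = ⊤

descend : Role → ℕ → Maybe ℕ → Maybe ℕ
descend closer zero _ = just zero
descend _ _ m = Maybe.map suc m

-- Reading u from height d, `height` is the final height and `firstNegative` the
-- position of the first closer read at height 0, beyond which `height` is meaningless;
-- `Safe r d` says that a letter of role r read at height d is not such a closer.
height : Fam → ℕ → List Letter → ℕ
height F d [] = d
height F d (x ∷ u) = height F (raise (role F x) d) u

firstNegative : Fam → ℕ → List Letter → Maybe ℕ
firstNegative F d [] = nothing
firstNegative F d (x ∷ u) = descend (role F x) d (firstNegative F (raise (role F x) d) u)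

Balanced : Fam → List Letter → Set
Balanced F u = firstNegative F 0 u ≡ nothing × height F 0 u ≡ 0

map≡nothing : ∀ {f : ℕ → ℕ} {m} → Maybe.map f m ≡ nothing → m ≡ nothing
map≡nothing {m = nothing} _ = refl

map-+≡just : ∀ k {m n} → Maybe.map (k +_) m ≡ just n → ∃[ j ] (n ≡ k + j × m ≡ just j)
map-+≡just k {just j} refl = j , refl , refl

descend-safe : ∀ r d m → Safe r d → descend r d m ≡ Maybe.map suc m
descend-safe opener d m _ = refl
descend-safe closer (suc d) m _ = refl
descend-safe other d m _ = refl

descend-nothing : ∀ r d {m} → Safe r d → m ≡ nothing → descend r d m ≡ nothing
descend-nothing r d safe refl = descend-safe r d nothing safe

descend≡nothing : ∀ r d m → descend r d m ≡ nothing → Safe r d × m ≡ nothing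
descend≡nothing opener d nothing _ = tt , refl
descend≡nothing closer (suc d) nothing _ = tt , refl
descend≡nothing other d nothing _ = tt , refl
descend≡nothing closer zero _ ()
descend≡nothing opener d (just _) ()
descend≡nothing closer (suc d) (just _) ()
descend≡nothing other d (just _) ()

descend≡just : ∀ r d m {n} → descend r d m ≡ just n
             → (r ≡ closer × d ≡ 0 × n ≡ 0) ⊎ (Safe r d × ∃[ n' ] (n ≡ suc n' × m ≡ just n'))
descend≡just closer zero m refl = inj₁ (refl , refl , refl)
descend≡just opener d (just n') refl = inj₂ (tt , n' , refl , refl)
descend≡just closer (suc d) (just n') refl = inj₂ (tt , n' , refl , refl)
descend≡just other d (just n') refl = inj₂ (tt , n' , refl , refl)

descend-resp-just : ∀ r d {m m'} → (∀ {n} → m ≡ just n → m' ≡ just n)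
                  → ∀ {n} → descend r d m ≡ just n → descend r d m' ≡ just n
descend-resp-just r d m⇒m' e with descend≡just r d _ e
... | inj₁ (refl , refl , refl) = refl
... | inj₂ (safe , n' , refl , e') = trans (descend-safe r d _ safe) (cong (Maybe.map suc) (m⇒m' e'))

descend-resp-nothing : ∀ r d {m m'} → ((m ≡ nothing) iff (m' ≡ nothing))
                     → (descend r d m ≡ nothing) iff (descend r d m' ≡ nothing)
descend-resp-nothing r d (m⇒m' , m'⇒m) = transfer m⇒m' , transfer m'⇒m
  where
  transfer : ∀ {m m'} → (m ≡ nothing → m' ≡ nothing) → descend r d m ≡ nothing → descend r d m' ≡ nothing
  transfer f e = let safe , e' = descend≡nothing r d _ e in descend-nothing r d safe (f e')

isOpener isCloser : Role → ℕ
isOpener opener = 1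
isOpener _ = 0
isCloser closer = 1
isCloser _ = 0

count-∷ : ∀ F x u → count (opn F) (x ∷ u) ≡ isOpener (role F x) + count (opn F) u
                  × count (cls F) (x ∷ u) ≡ isCloser (role F x) + count (cls F) u
count-∷ A a _ = refl , refl
count-∷ A ā _ = refl , refl
count-∷ A b _ = refl , refl
count-∷ A b̄ _ = refl , refl
count-∷ B a _ = refl , refl
count-∷ B ā _ = refl , refl
count-∷ B b _ = refl , refl
count-∷ B b̄ _ = refl , refl

Dominated : Fam → ℕ → List Letter → Set
Dominated F d u = ∀ m → count (cls F) (take m u) ≤ d + count (opn F) (take m u)

safe-of-≤ : ∀ r d → isCloser r + 0 ≤ d + (isOpener r + 0) → Safe r d
safe-of-≤ closer zero ()
safe-of-≤ closer (suc d) _ = tt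
safe-of-≤ opener d _ = tt
safe-of-≤ other d _ = tt

raise-≤ : ∀ r d {c o} → Safe r d → c ≤ raise r d + o → isCloser r + c ≤ d + (isOpener r + o)
raise-≤ opener d {o = o} _ le = ≤-trans le (≤-reflexive (sym (+-suc d o)))
raise-≤ closer (suc d) _ le = s≤s le
raise-≤ other d _ le = le

raise-≤⁻ : ∀ r d {c o} → isCloser r + c ≤ d + (isOpener r + o) → c ≤ raise r d + o
raise-≤⁻ opener d {o = o} le = ≤-trans le (≤-reflexive (+-suc d o))
raise-≤⁻ closer zero {c} le = ≤-trans (n≤1+n c) le
raise-≤⁻ closer (suc d) le = ≤-pred le
raise-≤⁻ other d le = le

raise-count : ∀ r d {h c o} → Safe r d → h + c ≡ raise r d + o → h + (isCloser r + c) ≡ d + (isOpener r + o)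
raise-count opener d {o = o} _ e = trans e (sym (+-suc d o))
raise-count closer (suc d) {h} {c} _ e = trans (+-suc h c) (cong suc e)
raise-count other d _ e = e

raise-+ : ∀ r e d → Safe r d → raise r (e + d) ≡ e + raise r d
raise-+ opener e d _ = sym (+-suc e d)
raise-+ closer e (suc d) _ = cong pred (+-suc e d)
raise-+ other e d _ = refl

safe-+ : ∀ r e d → Safe r d → Safe r (e + d)
safe-+ opener e d _ = tt
safe-+ closer e (suc d) _ = subst (Safe closer) (sym (+-suc e d)) tt
safe-+ other e d _ = tt

safe-closer⇒0< : ∀ {h} → Safe closer h → 0 < h
safe-closer⇒0< {suc _} _ = s≤s z≤n

module _ (F : Fam) where

  private
    count-bound : ∀ {d x} u → count (cls F) (x ∷ u) ≤ d + count (opn F) (x ∷ u)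
                → isCloser (role F x) + count (cls F) u ≤ d + (isOpener (role F x) + count (opn F) u)
    count-bound {d} {x} u = subst₂ (λ c o → c ≤ d + o) (proj₂ (count-∷ F x u)) (proj₁ (count-∷ F x u))

  dominated⇒noNegative : ∀ d u → Dominated F d u → firstNegative F d u ≡ nothing
  dominated⇒noNegative d [] _ = refl
  dominated⇒noNegative d (x ∷ u) dom =
    descend-nothing (role F x) d (safe-of-≤ (role F x) d (count-bound [] (dom 1)))
      (dominated⇒noNegative _ u λ m → raise-≤⁻ (role F x) d (count-bound (take m u) (dom (suc m))))

  noNegative⇒dominated : ∀ d u → firstNegative F d u ≡ nothing → Dominated F d u
  noNegative⇒dominated d u nn zero = z≤n
  noNegative⇒dominated d [] nn (suc m) = z≤n
  noNegative⇒dominated d (x ∷ u) nn (suc m) =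
    let safe , nn' = descend≡nothing (role F x) d _ nn in
    subst₂ (λ c o → c ≤ d + o) (sym (proj₂ (count-∷ F x (take m u)))) (sym (proj₁ (count-∷ F x (take m u))))
      (raise-≤ (role F x) d safe (noNegative⇒dominated _ u nn' m))

  height-count : ∀ d u → firstNegative F d u ≡ nothing → height F d u + count (cls F) u ≡ d + count (opn F) u
  height-count d [] _ = refl
  height-count d (x ∷ u) nn =
    let safe , nn' = descend≡nothing (role F x) d _ nn in
    subst₂ (λ c o → height F d (x ∷ u) + c ≡ d + o) (sym (proj₂ (count-∷ F x u))) (sym (proj₁ (count-∷ F x u)))
      (raise-count (role F x) d {height F d (x ∷ u)} {count (cls F) u} safe (height-count _ u nn'))

  height-++ : ∀ d u v → height F d (u ++ v) ≡ height F (height F d u) v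
  height-++ d [] v = refl
  height-++ d (x ∷ u) v = height-++ _ u v

  firstNegative-++-just : ∀ d u v {n} → firstNegative F d u ≡ just n → firstNegative F d (u ++ v) ≡ just n
  firstNegative-++-just d (x ∷ u) v = descend-resp-just (role F x) d (firstNegative-++-just _ u v)

  firstNegative-++ : ∀ d u v → firstNegative F d u ≡ nothing
                   → firstNegative F d (u ++ v) ≡ Maybe.map (length u +_) (firstNegative F (height F d u) v)
  firstNegative-++ d [] v _ = sym (map-id _)
  firstNegative-++ d (x ∷ u) v nn =
    let safe , nn' = descend≡nothing (role F x) d _ nn in
    trans (descend-safe (role F x) d _ safe)
          (trans (cong (Maybe.map suc) (firstNegative-++ _ u v nn')) (sym (map-∘ (firstNegative F (height F d (x ∷ u)) v))))

  firstNegative-++⁻ : ∀ d u v → firstNegative F d (u ++ v) ≡ nothing → firstNegative F d u ≡ nothing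
  firstNegative-++⁻ d [] v _ = refl
  firstNegative-++⁻ d (x ∷ u) v nn =
    let safe , nn' = descend≡nothing (role F x) d _ nn in
    descend-nothing (role F x) d safe (firstNegative-++⁻ _ u v nn')

  firstNegative≡just : ∀ d u {n} → firstNegative F d u ≡ just n
    → u at n ≡ just (cls F) × firstNegative F d (take n u) ≡ nothing × height F d (take n u) ≡ 0
  firstNegative≡just d (x ∷ u) e with descend≡just (role F x) d _ e
  ... | inj₁ (isCloser , refl , refl) = cong just (role≡closer F x isCloser) , refl , refl
  ... | inj₂ (safe , n' , refl , e') =
    let at-n , nn , h0 = firstNegative≡just _ u e' in
    at-n , descend-nothing (role F x) d safe nn , h0

  firstNegative-cls : ∀ u → firstNegative F 0 (cls F ∷ u) ≡ just 0
  firstNegative-cls u = cong (λ r → descend r 0 (firstNegative F (raise r 0) u)) (role-cls F)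

  firstNegative≡just⁻ : ∀ u {n} → u at n ≡ just (cls F) → Balanced F (take n u) → firstNegative F 0 u ≡ just n
  firstNegative≡just⁻ u {n} at-n (nn , h0) = begin
      firstNegative F 0 u
    ≡⟨ cong (firstNegative F 0) (at⇒take-∷-drop u n at-n) ⟩
      firstNegative F 0 (take n u ++ cls F ∷ drop (suc n) u)
    ≡⟨ firstNegative-++ 0 (take n u) _ nn ⟩
      Maybe.map (length (take n u) +_) (firstNegative F (height F 0 (take n u)) (cls F ∷ drop (suc n) u))
    ≡⟨ cong (λ h → Maybe.map (length (take n u) +_) (firstNegative F h (cls F ∷ drop (suc n) u))) h0 ⟩
      Maybe.map (length (take n u) +_) (firstNegative F 0 (cls F ∷ drop (suc n) u))
    ≡⟨ cong (Maybe.map (length (take n u) +_)) (firstNegative-cls (drop (suc n) u)) ⟩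
      just (length (take n u) + 0)
    ≡⟨ cong just (trans (+-identityʳ _) (length-take-≤ u (<⇒≤ (at⇒< u n at-n)))) ⟩
      just n
    ∎ where open ≡-Reasoning

  height-∷ʳ : ∀ d u x → height F d (u ∷ʳ x) ≡ raise (role F x) (height F d u)
  height-∷ʳ d u x = height-++ d u (x ∷ [])

  noNegative-∷ʳ : ∀ d u x → firstNegative F d (u ∷ʳ x) ≡ nothing
                → firstNegative F d u ≡ nothing × Safe (role F x) (height F d u)
  noNegative-∷ʳ d u x nn =
    let nn-u = firstNegative-++⁻ d u (x ∷ []) nn in
    nn-u , proj₁ (descend≡nothing (role F x) _ _ (map≡nothing (trans (sym (firstNegative-++ d u (x ∷ []) nn-u)) nn)))

  noNegative-∷ʳ⁻ : ∀ d u x → firstNegative F d u ≡ nothing → Safe (role F x) (height F d u)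
                 → firstNegative F d (u ∷ʳ x) ≡ nothing
  noNegative-∷ʳ⁻ d u x nn safe =
    trans (firstNegative-++ d u (x ∷ []) nn) (cong (Maybe.map (length u +_)) (descend-nothing (role F x) _ safe refl))

  firstNegative-∷ʳ : ∀ d u x {n} → firstNegative F d (u ∷ʳ x) ≡ just n
    → firstNegative F d u ≡ just n ⊎ (n ≡ length u × x ≡ cls F × firstNegative F d u ≡ nothing × height F d u ≡ 0)
  firstNegative-∷ʳ d u x e with firstNegative F d u in eq
  ... | just n' = inj₁ (cong just (just-injective (trans (sym (firstNegative-++-just d u (x ∷ []) eq)) e)))
  ... | nothing with map-+≡just (length u) {descend (role F x) (height F d u) nothing} (trans (sym (firstNegative-++ d u (x ∷ []) eq)) e)
  ... | k , refl , e' with descend≡just (role F x) (height F d u) nothing e'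
  ...   | inj₁ (isCloser , h0 , refl) = inj₂ (+-identityʳ (length u) , role≡closer F x isCloser , refl , h0)
  ...   | inj₂ (_ , _ , _ , ())

  firstNegative-∷ʳ⁻ : ∀ d u → firstNegative F d u ≡ nothing → height F d u ≡ 0
                    → firstNegative F d (u ∷ʳ cls F) ≡ just (length u)
  firstNegative-∷ʳ⁻ d u nn h0 = begin
      firstNegative F d (u ∷ʳ cls F)
    ≡⟨ firstNegative-++ d u (cls F ∷ []) nn ⟩
      Maybe.map (length u +_) (firstNegative F (height F d u) (cls F ∷ []))
    ≡⟨ cong (λ h → Maybe.map (length u +_) (firstNegative F h (cls F ∷ []))) h0 ⟩
      Maybe.map (length u +_) (firstNegative F 0 (cls F ∷ []))
    ≡⟨ cong (Maybe.map (length u +_)) (firstNegative-cls []) ⟩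
      just (length u + 0)
    ≡⟨ cong just (+-identityʳ _) ⟩
      just (length u)
    ∎ where open ≡-Reasoning

  noNegative-+ : ∀ e d u → firstNegative F d u ≡ nothing
               → firstNegative F (e + d) u ≡ nothing × height F (e + d) u ≡ e + height F d u
  noNegative-+ e d [] _ = refl , refl
  noNegative-+ e d (x ∷ u) nn =
    let safe , nn' = descend≡nothing (role F x) d _ nn
        nn-e , h-e = noNegative-+ e _ u nn'
        shift = raise-+ (role F x) e d safe
    in descend-nothing (role F x) (e + d) (safe-+ (role F x) e d safe)
         (trans (cong (λ d' → firstNegative F d' u) shift) nn-e)
       , trans (cong (λ d' → height F d' u) shift) h-e

iff-map-suc : ∀ {m m' : Maybe ℕ} → (m ≡ nothing) iff (m' ≡ nothing) → (m ≡ nothing) iff (Maybe.map suc m' ≡ nothing)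
iff-map-suc (to , from) = (λ e → cong (Maybe.map suc) (to e)) , (λ e → from (map≡nothing e))

firstNegative-sub : ∀ F d u → (firstNegative F d (sub F u) ≡ nothing) iff (firstNegative F d u ≡ nothing)
firstNegative-sub F d [] = id , id
firstNegative-sub A d (a ∷ u) = descend-resp-nothing opener d (firstNegative-sub A _ u)
firstNegative-sub A d (ā ∷ u) = descend-resp-nothing closer d (firstNegative-sub A _ u)
firstNegative-sub A d (b ∷ u) = iff-map-suc (firstNegative-sub A d u)
firstNegative-sub A d (b̄ ∷ u) = iff-map-suc (firstNegative-sub A d u)
firstNegative-sub B d (a ∷ u) = iff-map-suc (firstNegative-sub B d u)
firstNegative-sub B d (ā ∷ u) = iff-map-suc (firstNegative-sub B d u)
firstNegative-sub B d (b ∷ u) = descend-resp-nothing opener d (firstNegative-sub B _ u)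
firstNegative-sub B d (b̄ ∷ u) = descend-resp-nothing closer d (firstNegative-sub B _ u)

height-sub : ∀ F d u → height F d (sub F u) ≡ height F d u
height-sub F d [] = refl
height-sub A d (a ∷ u) = height-sub A _ u
height-sub A d (ā ∷ u) = height-sub A _ u
height-sub A d (b ∷ u) = height-sub A _ u
height-sub A d (b̄ ∷ u) = height-sub A _ u
height-sub B d (a ∷ u) = height-sub B _ u
height-sub B d (ā ∷ u) = height-sub B _ u
height-sub B d (b ∷ u) = height-sub B _ u
height-sub B d (b̄ ∷ u) = height-sub B _ u

balanced-sub : ∀ F u → Balanced F (sub F u) iff Balanced F u
balanced-sub F u = (λ (nn , h0) → proj₁ (firstNegative-sub F 0 u) nn , trans (sym (height-sub F 0 u)) h0)
                 , (λ (nn , h0) → proj₂ (firstNegative-sub F 0 u) nn , trans (height-sub F 0 u) h0)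

balanced⇔parenSys : ∀ F s → Balanced F s iff ParenSys F s
balanced⇔parenSys F s = to , from
  where
  to : Balanced F s → ParenSys F s
  to (nn , h0) = sym (subst (λ h → h + count (cls F) s ≡ count (opn F) s) h0 (height-count F 0 s nn))
               , noNegative⇒dominated F 0 s nn
  from : ParenSys F s → Balanced F s
  from (o≡c , dom) = nn , +-cancelʳ-≡ (count (cls F) s) (height F 0 s) 0 (trans (height-count F 0 s nn) o≡c)
    where nn = dominated⇒noNegative F 0 s dom

paired⇔ : ∀ F w i j → Paired F w i j
        iff (i < j × w at i ≡ just (opn F) × firstNegative F 0 (drop (suc i) w) ≡ just (j ∸ suc i))
paired⇔ F w i j = to , from
  where
  Matched : Set
  Matched = i < j × w at i ≡ just (opn F) × firstNegative F 0 (drop (suc i) w) ≡ just (j ∸ suc i)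
  to : Paired F w i j → Matched
  to (i<j , at-i , at-j , ps) =
    i<j , at-i , firstNegative≡just⁻ F (drop (suc i) w) (trans (at-drop-∸ w i<j) at-j)
                   (proj₁ (balanced-sub F (between i j w)) (proj₂ (balanced⇔parenSys F _) ps))
  from : Matched → Paired F w i j
  from (i<j , at-i , fn) =
    let at-j , bal = firstNegative≡just F 0 (drop (suc i) w) fn in
    i<j , at-i , trans (sym (at-drop-∸ w i<j)) at-j , proj₁ (balanced⇔parenSys F _) (proj₂ (balanced-sub F (between i j w)) bal)

Unmatched : Fam → List Letter → ℕ → Set
Unmatched F w i = w at i ≡ just (opn F) × firstNegative F 0 (drop (suc i) w) ≡ nothing

Unpaired : Fam → List Letter → ℕ → Set
Unpaired F w i = w at i ≡ just (opn F) × ¬ (∃[ j ] Paired F w i j)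

LastUnmatched : Fam → List Letter → ℕ → Set
LastUnmatched F w e = Unmatched F w e × height F 0 (drop (suc e) w) ≡ 0

unmatched⇒unpaired : ∀ F w i → Unmatched F w i → Unpaired F w i
unmatched⇒unpaired F w i (at-i , nn) = at-i , λ (j , p) → just≢nothing (trans (sym (proj₂ (proj₂ (proj₁ (paired⇔ F w i j) p)))) nn)
  where
  just≢nothing : ∀ {n} → just n ≢ nothing
  just≢nothing ()

unpaired⇒unmatched : ∀ F w i → Unpaired F w i → Unmatched F w i
unpaired⇒unmatched F w i (at-i , unpaired) with firstNegative F 0 (drop (suc i) w) in eq
... | nothing = at-i , refl
... | just r = ⊥-elim (unpaired (suc i + r , proj₂ (paired⇔ F w i (suc i + r))
                 (s≤s (m≤m+n i r) , at-i , trans eq (cong just (sym (m+n∸m≡n (suc i) r))))))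

paired-∷ʳ : ∀ F w x i j → Paired F (w ∷ʳ x) i j
          → Paired F w i j ⊎ (j ≡ length w × x ≡ cls F × LastUnmatched F w i)
paired-∷ʳ F w x i j p@(i<j , _ , at-j , _) = split (proj₁ (paired⇔ F (w ∷ʳ x) i j) p)
  where
  i<n : i < length w
  i<n = <-≤-trans i<j (at-∷ʳ⇒≤ w x at-j)
  at-w : ∀ {y} → (w ∷ʳ x) at i ≡ just y → w at i ≡ just y
  at-w = trans (sym (at-++ˡ w (x ∷ []) i<n))
  split : i < j × (w ∷ʳ x) at i ≡ just (opn F) × firstNegative F 0 (drop (suc i) (w ∷ʳ x)) ≡ just (j ∸ suc i)
        → Paired F w i j ⊎ (j ≡ length w × x ≡ cls F × LastUnmatched F w i)
  split (_ , at-i , fn) with firstNegative-∷ʳ F 0 (drop (suc i) w) x (trans (cong (firstNegative F 0) (sym (drop-++ˡ w (x ∷ []) i<n))) fn)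
  ... | inj₁ fn' = inj₁ (proj₂ (paired⇔ F w i j) (i<j , at-w at-i , fn'))
  ... | inj₂ (j∸≡ , x≡ , nn , h0) = inj₂ (∸-cancelʳ-≡ i<j i<n (trans j∸≡ (length-drop (suc i) w)) , x≡ , (at-w at-i , nn) , h0)

paired-∷ʳ⁻ : ∀ F w x i j → Paired F w i j ⊎ (j ≡ length w × x ≡ cls F × LastUnmatched F w i)
           → Paired F (w ∷ʳ x) i j
paired-∷ʳ⁻ F w x i j (inj₁ p@(i<j , _ , at-j , _)) =
  let _ , at-i , fn = proj₁ (paired⇔ F w i j) p
      i<n = <-trans i<j (at⇒< w j at-j)
  in proj₂ (paired⇔ F (w ∷ʳ x) i j)
       (i<j , trans (at-++ˡ w (x ∷ []) i<n) at-i
            , trans (cong (firstNegative F 0) (drop-++ˡ w (x ∷ []) i<n)) (firstNegative-++-just F 0 (drop (suc i) w) (x ∷ []) fn))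
paired-∷ʳ⁻ F w x i j (inj₂ (refl , refl , (at-i , nn) , h0)) =
  let i<n = at⇒< w i at-i
  in proj₂ (paired⇔ F (w ∷ʳ x) i j)
       (i<n , trans (at-++ˡ w (x ∷ []) i<n) at-i
            , trans (cong (firstNegative F 0) (drop-++ˡ w (x ∷ []) i<n))
                    (trans (firstNegative-∷ʳ⁻ F 0 (drop (suc i) w) nn h0) (cong just (length-drop (suc i) w))))

paired-∷ʳ-other : ∀ F w x i j → x ≢ cls F → Paired F (w ∷ʳ x) i j iff Paired F w i j
paired-∷ʳ-other F w x i j x≢ =
    (λ p → [ id , (λ (_ , x≡ , _) → ⊥-elim (x≢ x≡)) ]′ (paired-∷ʳ F w x i j p))
  , (λ p → paired-∷ʳ⁻ F w x i j (inj₁ p))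

newest-unpaired : ∀ F w x → ¬ (∃[ j ] Paired F (w ∷ʳ x) (length w) j)
newest-unpaired F w x (j , n<j , _ , at-j , _) = <⇒≱ n<j (at-∷ʳ⇒≤ w x at-j)

module _ (F : Fam) where

  unmatched-∷ʳ : ∀ s x q {h} → Unmatched F s q → height F 0 (drop (suc q) s) ≡ h → Safe (role F x) h
               → Unmatched F (s ∷ʳ x) q × height F 0 (drop (suc q) (s ∷ʳ x)) ≡ raise (role F x) h
  unmatched-∷ʳ s x q (at-q , nn) refl safe =
    (trans (at-++ˡ s (x ∷ []) q<) at-q , trans (cong (firstNegative F 0) suffix) (noNegative-∷ʳ⁻ F 0 (drop (suc q) s) x nn safe))
    , trans (cong (height F 0) suffix) (height-∷ʳ F 0 (drop (suc q) s) x)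
    where
    q< : q < length s
    q< = at⇒< s q at-q
    suffix : drop (suc q) (s ∷ʳ x) ≡ drop (suc q) s ∷ʳ x
    suffix = drop-++ˡ s (x ∷ []) q<

  unmatched-last : ∀ s x → role F x ≡ opener
                 → Unmatched F (s ∷ʳ x) (length s) × height F 0 (drop (suc (length s)) (s ∷ʳ x)) ≡ 0
  unmatched-last s x isOpener =
    (trans (at-∷ʳ-length s x) (cong just (role≡opener F x isOpener)) , cong (firstNegative F 0) (drop-suc-length s x))
    , cong (height F 0) (drop-suc-length s x)

  private
    -- The suffix after the sought letter has height k after the last letter (of role r) and
    -- height k' before it, unless the last letter is itself the sought opener (k = 0).
    height-before-last : ∀ d r H k → Safe r H → d + k < raise r H
             → (r ≡ opener × k ≡ 0) ⊎ ∃[ k' ] (raise r k' ≡ k × Safe r k' × d + k' < H)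
    height-before-last d opener H zero _ _ = inj₁ (refl , refl)
    height-before-last d opener H (suc k) _ lt = inj₂ (k , refl , tt , ≤-pred (subst (_< suc H) (+-suc d k) lt))
    height-before-last d closer (suc H) k _ lt = inj₂ (suc k , refl , tt , subst (_< suc H) (sym (+-suc d k)) (s≤s lt))
    height-before-last d other H k _ lt = inj₂ (k , refl , tt , lt)

  unmatched-of-height : ∀ d {s} → Reverse s → ∀ k → firstNegative F d s ≡ nothing → d + k < height F d s
                      → ∃[ q ] (Unmatched F s q × height F 0 (drop (suc q) s) ≡ k)
  unmatched-of-height d [] k _ d+k<d = ⊥-elim (m+n≮m d k d+k<d)
  unmatched-of-height d (s ∶ rs ∶ʳ x) k nn lt with noNegative-∷ʳ F d s x nn
  ... | nn-s , safe with height-before-last d (role F x) (height F d s) k safe (subst (d + k <_) (height-∷ʳ F d s x) lt)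
  ... | inj₁ (isOpener , refl) = length s , unmatched-last s x isOpener
  ... | inj₂ (k' , refl , safe' , lt') with unmatched-of-height d rs k' nn-s lt'
  ... | q , u , h = q , unmatched-∷ʳ s x q u h safe'

  height-unmatched : ∀ w p → Unmatched F w p
                   → height F 0 w ≡ suc (height F 0 (take p w) + height F 0 (drop (suc p) w))
  height-unmatched w p (at-p , nn) = begin
      height F 0 w
    ≡⟨ cong (height F 0) (at⇒take-∷-drop w p at-p) ⟩
      height F 0 (take p w ++ opn F ∷ rest)
    ≡⟨ height-++ F 0 (take p w) _ ⟩
      height F (raise (role F (opn F)) m) rest
    ≡⟨ cong (λ r → height F (raise r m) rest) (role-opn F) ⟩
      height F (suc m) rest
    ≡⟨ cong (λ d → height F d rest) (sym (+-identityʳ (suc m))) ⟩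
      height F (suc m + 0) rest
    ≡⟨ proj₂ (noNegative-+ F (suc m) 0 rest nn) ⟩
      suc (m + height F 0 rest)
    ∎
    where
    open ≡-Reasoning
    m = height F 0 (take p w)
    rest = drop (suc p) w

  unmatched⇒height>0 : ∀ w p → Unmatched F w p → 0 < height F 0 w
  unmatched⇒height>0 w p u = subst (0 <_) (sym (height-unmatched w p u)) (s≤s z≤n)

  height≡0⇒¬unmatched : ∀ w p → height F 0 w ≡ 0 → ¬ Unmatched F w p
  height≡0⇒¬unmatched w p h0 u = <-irrefl (sym h0) (unmatched⇒height>0 w p u)

  unmatched-drop : ∀ w e q → Unmatched F (drop (suc e) w) q iff Unmatched F w (suc e + q)
  unmatched-drop w e q =
      (λ (at-q , nn) → trans (sym (at-drop w (suc e) q)) at-q , trans (cong (firstNegative F 0) (sym (drop-drop-suc w e q))) nn)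
    , (λ (at-q , nn) → trans (at-drop w (suc e) q) at-q , trans (cong (firstNegative F 0) (drop-drop-suc w e q)) nn)

  unmatched-take : ∀ t {p r} → p < r → Unmatched F t p → Unmatched F (take r t) p
  unmatched-take t {p} {r} p<r (at-p , nn) =
    trans (at-take t p<r) at-p
    , firstNegative-++⁻ F 0 (drop (suc p) (take r t)) (drop r t)
        (trans (cong (firstNegative F 0) (drop-take-++ t p<r)) nn)

  unmatched-before-last : ∀ w e i → LastUnmatched F w e → Unmatched F w i → i ≢ e → i < e
  unmatched-before-last w e i (_ , h0) u i≢e with <-cmp i e
  ... | tri< i<e _ _ = i<e
  ... | tri≈ _ i≡e _ = ⊥-elim (i≢e i≡e)
  ... | tri> _ _ e<i = ⊥-elim (height≡0⇒¬unmatched (drop (suc e) w) (i ∸ suc e) h0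
          (proj₂ (unmatched-drop w e (i ∸ suc e)) (subst (Unmatched F w) (sym (m+[n∸m]≡n e<i)) u)))

  last-unmatched : ∀ w e → Unmatched F w e → (∀ i → Unmatched F w i → i ≤ e) → LastUnmatched F w e
  last-unmatched w e u@(_ , nn) maximal with height F 0 (drop (suc e) w) in eq
  ... | zero = u , refl
  ... | suc _ with unmatched-of-height 0 (reverseView (drop (suc e) w)) 0 nn (subst (0 <_) (sym eq) (s≤s z≤n))
  ... | q , u' , _ = ⊥-elim (m+n≮m e q (maximal (suc e + q) (proj₁ (unmatched-drop w e q) u')))

  lastUnmatched-exists : ∀ w → firstNegative F 0 w ≡ nothing → 0 < height F 0 w → ∃[ e ] LastUnmatched F w e
  lastUnmatched-exists w nn pos = unmatched-of-height 0 (reverseView w) 0 nn pos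

  lastUnmatched-unique : ∀ w e e' → LastUnmatched F w e → LastUnmatched F w e' → e ≡ e'
  lastUnmatched-unique w e e' last last' with e ≟ e'
  ... | yes e≡e' = e≡e'
  ... | no e≢e' = ⊥-elim (<-asym (unmatched-before-last w e' e last' (proj₁ last) e≢e')
                                 (unmatched-before-last w e e' last (proj₁ last') (e≢e' ∘ sym)))

unmatched-inside : ∀ F w {q i e} → q < i → i < e → Unmatched F w i → Unmatched F (drop (suc q) (take e w)) (i ∸ suc q)
unmatched-inside F w {q} {i} {e} q<i i<e u =
  proj₂ (unmatched-drop F (take e w) q (i ∸ suc q)) (subst (Unmatched F (take e w)) (sym (m+[n∸m]≡n q<i)) (unmatched-take F w i<e u))

length-steps : ∀ p u → length (steps p u) ≡ length u
length-steps p [] = refl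
length-steps p (x ∷ u) = cong suc (length-steps (suc p) u)

steps-++ : ∀ p u v → steps p (u ++ v) ≡ steps p u ++ steps (p + length u) v
steps-++ p [] v = cong (λ q → steps q v) (sym (+-identityʳ p))
steps-++ p (x ∷ u) v = cong (stepOf p x ∷_) (trans (steps-++ (suc p) u v) (cong (λ q → steps (suc p) u ++ steps q v) (sym (+-suc p (length u)))))

concatEv-++ : ∀ xs ys → concatEv (xs ++ ys) ≡ concatEv xs ++ concatEv ys
concatEv-++ [] ys = refl
concatEv-++ (s ∷ xs) ys = trans (cong (stepEvents s ++_) (concatEv-++ xs ys)) (sym (++-assoc (stepEvents s) (concatEv xs) (concatEv ys)))

concatEv-++-ups : ∀ xs k → concatEv (xs ++ replicate k up) ≡ concatEv xs
concatEv-++-ups [] zero = refl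
concatEv-++-ups [] (suc k) = concatEv-++-ups [] k
concatEv-++-ups (s ∷ xs) k = cong (stepEvents s ++_) (concatEv-++-ups xs k)

root-events : List (Σ Kind Item)
root-events = (vK , rootV) ∷ (hK , rootH) ∷ []

events-M : ∀ w → events (M w) ≡ root-events ++ concatEv (steps 0 w)
events-M w = cong (root-events ++_) (concatEv-++-ups (steps 0 w) _)

events-∷ʳ : ∀ w x → events (M (w ∷ʳ x)) ≡ events (M w) ++ stepEvents (stepOf (length w) x)
events-∷ʳ w x = cong (root-events ++_) (begin
    concatEv (contour (M (w ∷ʳ x)))
  ≡⟨ concatEv-++-ups (steps 0 (w ∷ʳ x)) _ ⟩
    concatEv (steps 0 (w ∷ʳ x))
  ≡⟨ cong concatEv (steps-++ 0 w (x ∷ [])) ⟩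
    concatEv (steps 0 w ++ stepOf (length w) x ∷ [])
  ≡⟨ concatEv-++ (steps 0 w) _ ⟩
    concatEv (steps 0 w) ++ stepEvents (stepOf (length w) x) ++ []
  ≡⟨ cong (concatEv (steps 0 w) ++_) (++-identityʳ _) ⟩
    concatEv (steps 0 w) ++ stepEvents (stepOf (length w) x)
  ≡⟨ cong (_++ stepEvents (stepOf (length w) x)) (sym (concatEv-++-ups (steps 0 w) _)) ⟩
    concatEv (contour (M w)) ++ stepEvents (stepOf (length w) x)
  ∎)
  where open ≡-Reasoning

concatEv-steps-at : ∀ p u i {x} j {z} → u at i ≡ just x → stepEvents (stepOf (p + i) x) at j ≡ just z
                  → ∃[ q ] (concatEv (steps p u) at q ≡ just z)
concatEv-steps-at p (x ∷ u) zero j {z} refl e =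
  let e' = subst (λ r → stepEvents (stepOf r x) at j ≡ just z) (+-identityʳ p) e in
  j , trans (at-++ˡ (stepEvents (stepOf p x)) _ (at⇒< (stepEvents (stepOf p x)) j e')) e'
concatEv-steps-at p (y ∷ u) (suc i) {x} j {z} at-i e
  with concatEv-steps-at (suc p) u i j at-i (subst (λ r → stepEvents (stepOf r x) at j ≡ just z) (+-suc p i) e)
... | q , e' = length (stepEvents (stepOf p y)) + q , trans (at-++-length (stepEvents (stepOf p y)) _ q) e'

concatEv-steps-at⁻ : ∀ p u q {z} → concatEv (steps p u) at q ≡ just z
                   → ∃[ i ] ∃[ x ] ∃[ j ] (u at i ≡ just x × stepEvents (stepOf (p + i) x) at j ≡ just z)
concatEv-steps-at⁻ p (x ∷ u) q {z} e with at-++⁻ (stepEvents (stepOf p x)) _ q e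
... | inj₁ e' = 0 , x , q , refl , subst (λ r → stepEvents (stepOf r x) at q ≡ just z) (sym (+-identityʳ p)) e'
... | inj₂ (_ , e') with concatEv-steps-at⁻ (suc p) u _ e'
...   | i , y , j , at-i , e'' = suc i , y , j , at-i , subst (λ r → stepEvents (stepOf r y) at j ≡ just z) (sym (+-suc p i)) e''

-- The events of the letter at position i have ranks 4i+2 to 4i+5, above those
-- of the root; linkE items never occur as events.
rank : Σ Kind Item → ℕ
rank (_ , rootV) = 0
rank (_ , rootH) = 1
rank (_ , treeTail i) = 2 + i * 4
rank (_ , headH j) = 2 + j * 4
rank (_ , tailH j) = 2 + j * 4
rank (_ , treeE i) = 3 + i * 4
rank (_ , treeHead i) = 4 + i * 4
rank (_ , childV i) = 5 + i * 4
rank (_ , linkE _) = 0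

Ascending : ℕ → List (Σ Kind Item) → Set
Ascending lo [] = ⊤
Ascending lo (z ∷ zs) = lo ≤ rank z × Ascending (suc (rank z)) zs

ascending-weaken : ∀ {lo lo'} zs → lo' ≤ lo → Ascending lo zs → Ascending lo' zs
ascending-weaken [] _ _ = tt
ascending-weaken (z ∷ zs) lo'≤lo (lo≤ , asc) = ≤-trans lo'≤lo lo≤ , asc

ascending-lower : ∀ {lo} zs p {z} → Ascending lo zs → zs at p ≡ just z → lo ≤ rank z
ascending-lower (y ∷ zs) zero (lo≤ , _) refl = lo≤
ascending-lower (y ∷ zs) (suc p) (lo≤ , asc) e = ≤-trans lo≤ (<⇒≤ (ascending-lower zs p asc e))

ascending-at : ∀ {lo} zs {p q z z'} → Ascending lo zs → zs at p ≡ just z → zs at q ≡ just z' → p < q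
             → rank z < rank z'
ascending-at (y ∷ zs) {zero} {suc q} (_ , asc) refl e' _ = ascending-lower zs q asc e'
ascending-at (y ∷ zs) {suc p} {suc q} (_ , asc) e e' (s≤s p<q) = ascending-at zs asc e e' p<q

ascending-steps : ∀ p u → Ascending (2 + p * 4) (concatEv (steps p u))
ascending-steps p [] = tt
ascending-steps p (a ∷ u) = ≤-refl , ≤-refl , ≤-refl , ≤-refl , ascending-steps (suc p) u
ascending-steps p (ā ∷ u) = ascending-weaken (concatEv (steps (suc p) u)) (m≤n+m _ 4) (ascending-steps (suc p) u)
ascending-steps p (b ∷ u) = ≤-refl , ascending-weaken (concatEv (steps (suc p) u)) (m≤n+m _ 3) (ascending-steps (suc p) u)
ascending-steps p (b̄ ∷ u) = ≤-refl , ascending-weaken (concatEv (steps (suc p) u)) (m≤n+m _ 3) (ascending-steps (suc p) u)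

ascending-events : ∀ w → Ascending 0 (events (M w))
ascending-events w = subst (Ascending 0) (sym (events-M w)) (z≤n , s≤s z≤n , ascending-steps 0 w)

rank-stepEvents≥ : ∀ p x j {z} → stepEvents (stepOf p x) at j ≡ just z → 2 + p * 4 ≤ rank z
rank-stepEvents≥ p x j e =
  ascending-lower (stepEvents (stepOf p x) ++ []) j (ascending-steps p (x ∷ []))
    (trans (at-++ˡ (stepEvents (stepOf p x)) [] (at⇒< (stepEvents (stepOf p x)) j e)) e)

events-∷ʳ-at : ∀ w x p {z} → events (M w) at p ≡ just z → events (M (w ∷ʳ x)) at p ≡ just z
events-∷ʳ-at w x p e =
  trans (cong (_at p) (events-∷ʳ w x)) (trans (at-++ˡ (events (M w)) _ (at⇒< (events (M w)) p e)) e)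

rank-events< : ∀ w p {z} → events (M w) at p ≡ just z → rank z < 2 + length w * 4
rank-events< w p e =
  ascending-at (events (M (w ∷ʳ a))) (ascending-events (w ∷ʳ a)) (events-∷ʳ-at w a p e) first-new
    (<-≤-trans (at⇒< (events (M w)) p e) (≤-reflexive (sym (+-identityʳ _))))
  where
  first-new : events (M (w ∷ʳ a)) at (length (events (M w)) + 0) ≡ just (hK , treeTail (length w))
  first-new = trans (cong (_at (length (events (M w)) + 0)) (events-∷ʳ w a)) (at-++-length (events (M w)) _ 0)

events-∷ʳ-at⁻ : ∀ w x p {z} → rank z < 2 + length w * 4 → events (M (w ∷ʳ x)) at p ≡ just z → events (M w) at p ≡ just z
events-∷ʳ-at⁻ w x p r< e with at-++⁻ (events (M w)) _ p (trans (cong (_at p) (sym (events-∷ʳ w x))) e)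
... | inj₁ e' = e'
... | inj₂ (_ , e') = ⊥-elim (<⇒≱ r< (rank-stepEvents≥ (length w) x _ e'))

rank-letter< : ∀ {i n} → i < n → 2 + i * 4 < 2 + n * 4
rank-letter< i<n = +-monoʳ-< 2 (*-monoˡ-< 4 i<n)

data NonLink : {k : Kind} → Item k → Set where
  nl-rootV : NonLink rootV
  nl-childV : ∀ i → NonLink (childV i)
  nl-rootH : NonLink rootH
  nl-treeTail : ∀ i → NonLink (treeTail i)
  nl-treeHead : ∀ i → NonLink (treeHead i)
  nl-headH : ∀ j → NonLink (headH j)
  nl-tailH : ∀ j → NonLink (tailH j)
  nl-treeE : ∀ i → NonLink (treeE i)

occ⇔ : ∀ m {k} {x : Item k} {p} → NonLink x → Occ m x p iff (events m at p ≡ just (k , x))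
occ⇔ m nl-rootV = id , id
occ⇔ m (nl-childV i) = id , id
occ⇔ m nl-rootH = id , id
occ⇔ m (nl-treeTail i) = id , id
occ⇔ m (nl-treeHead i) = id , id
occ⇔ m (nl-headH j) = id , id
occ⇔ m (nl-tailH j) = id , id
occ⇔ m (nl-treeE i) = id , id

module _ (m : PMap) (asc : Ascending 0 (events m)) {k : Kind} where

  firstOcc : ∀ {x : Item k} {p} → NonLink x → events m at p ≡ just (k , x) → FirstOcc m x p
  firstOcc nl e = proj₂ (occ⇔ m nl) e
    , λ p' o' → ≮⇒≥ (λ p'<p → <-irrefl refl (ascending-at (events m) asc (proj₁ (occ⇔ m nl) o') e p'<p))

  before-by-rank : ∀ {x y : Item k} → NonLink x → NonLink y → Present m x → Present m y
                 → rank (k , x) < rank (k , y) → Before m x y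
  before-by-rank nx ny (p , ox) (q , oy) lt with <-cmp p q
  ... | tri< p<q _ _ = p , q , firstOcc nx ex , firstOcc ny ey , p<q
    where ex = proj₁ (occ⇔ m nx) ox
          ey = proj₁ (occ⇔ m ny) oy
  ... | tri≈ _ refl _ = ⊥-elim (<-irrefl (cong rank (just-injective (trans (sym (proj₁ (occ⇔ m nx) ox)) (proj₁ (occ⇔ m ny) oy)))) lt)
  ... | tri> _ _ q<p = ⊥-elim (<-asym lt (ascending-at (events m) asc (proj₁ (occ⇔ m ny) oy) (proj₁ (occ⇔ m nx) ox) q<p))

  before⇒rank< : ∀ {x y : Item k} → NonLink x → NonLink y → Before m x y → rank (k , x) < rank (k , y)
  before⇒rank< nx ny (p , q , (ox , _) , (oy , _) , p<q) =
    ascending-at (events m) asc (proj₁ (occ⇔ m nx) ox) (proj₁ (occ⇔ m ny) oy) p<q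

sameOrder-of-occ : ∀ m m' → (∀ {k} (y : Item k) → Present m y → ∀ p → Occ m y p iff Occ m' y p) → SameOrder m m'
sameOrder-of-occ m m' same x y px py = transport same , transport (λ z pz p → swap-iff (same z pz p))
  where
  transport : ∀ {m₁ m₂} → (∀ {k} (z : Item k) → Present m z → ∀ p → Occ m₁ z p iff Occ m₂ z p)
            → Before m₁ x y → Before m₂ x y
  transport same' (p , q , (ox , min-x) , (oy , min-y) , p<q) =
    p , q , (proj₁ (same' x px p) ox , λ p' o' → min-x p' (proj₂ (same' x px p') o'))
          , (proj₁ (same' y py q) oy , λ q' o' → min-y q' (proj₂ (same' y py q') o')) , p<q

present-letter : ∀ w i {x} j {k} {y : Item k} → NonLink y → w at i ≡ just x
               → stepEvents (stepOf i x) at j ≡ just (k , y) → Present (M w) y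
present-letter w i j nl at-i e =
  let q , e' = concatEv-steps-at 0 w i j at-i e in
  2 + q , proj₂ (occ⇔ (M w) nl) (trans (cong (_at (2 + q)) (events-M w)) e')

present⇒rank< : ∀ w {k} {y : Item k} → NonLink y → Present (M w) y → rank (k , y) < 2 + length w * 4
present⇒rank< w nl (p , o) = rank-events< w p (proj₁ (occ⇔ (M w) nl) o)

fresh : ∀ w {k} {y : Item k} → NonLink y → 2 + length w * 4 ≤ rank (k , y) → ¬ Present (M w) y
fresh w nl r≥ pr = <⇒≱ (present⇒rank< w nl pr) r≥

stepEvents-headH : ∀ i x j {h} → stepEvents (stepOf i x) at j ≡ just (hK , headH h) → i ≡ h × x ≡ b
stepEvents-headH i b zero refl = refl , refl
stepEvents-headH i a zero ()
stepEvents-headH i a (suc zero) ()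
stepEvents-headH i a (suc (suc zero)) ()
stepEvents-headH i a (suc (suc (suc zero))) ()
stepEvents-headH i a (suc (suc (suc (suc j)))) ()
stepEvents-headH i ā j ()
stepEvents-headH i b (suc j) ()
stepEvents-headH i b̄ zero ()
stepEvents-headH i b̄ (suc j) ()

event-headH : ∀ w q {h} → events (M w) at q ≡ just (hK , headH h) → w at h ≡ just b
event-headH w (suc (suc q)) e
  with concatEv-steps-at⁻ 0 w q (trans (sym (cong (_at q) (concatEv-++-ups (steps 0 w) _))) e)
... | i , x , j , at-i , e' with stepEvents-headH i x j e'
...   | refl , refl = at-i

link-∷ʳ : ∀ w x {h t₀} → Paired B w h t₀ → ∀ t → Paired B (w ∷ʳ x) h t iff Paired B w h t
link-∷ʳ w x {h} {t₀} p₀ t =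
    (λ p → [ id , (λ (_ , _ , u , _) → ⊥-elim (proj₂ (unmatched⇒unpaired B w h u) (t₀ , p₀))) ]′ (paired-∷ʳ B w x h t p))
  , (λ p → paired-∷ʳ⁻ B w x h t (inj₁ p))

-- Appending a letter only adds events of higher rank, and a head paired in w keeps its tail.
sameOrder-∷ʳ : ∀ w x → SameOrder (M w) (M (w ∷ʳ x))
sameOrder-∷ʳ w x = sameOrder-of-occ (M w) (M (w ∷ʳ x)) same
  where
  n = length w
  old-event : ∀ {p z} → rank z < 2 + n * 4 → (events (M w) at p ≡ just z) iff (events (M (w ∷ʳ x)) at p ≡ just z)
  old-event {p} r< = events-∷ʳ-at w x p , events-∷ʳ-at⁻ w x p r<
  nonLink : ∀ {k} {y : Item k} → NonLink y → Present (M w) y → ∀ p → Occ (M w) y p iff Occ (M (w ∷ʳ x)) y p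
  nonLink nl pr p =
      (λ o → proj₂ (occ⇔ _ nl) (proj₁ old (proj₁ (occ⇔ _ nl) o)))
    , (λ o → proj₂ (occ⇔ _ nl) (proj₂ old (proj₁ (occ⇔ _ nl) o)))
    where old = old-event {p} (present⇒rank< w nl pr)
  link : ∀ h → Present (M w) (linkE h) → ∀ p → Occ (M w) (linkE h) p iff Occ (M (w ∷ʳ x)) (linkE h) p
  link h (_ , o₀) p = to , from
    where
    linked : ∃[ t ] Paired B w h t
    linked = [ proj₂ , (λ (t , _ , l) → t , l) ]′ o₀
    same-links : ∀ t → Paired B (w ∷ʳ x) h t iff Paired B w h t
    same-links = link-∷ʳ w x (proj₂ linked)
    rank-letters< : ∀ {t} → Paired B w h t → 2 + h * 4 < 2 + n * 4 × 2 + t * 4 < 2 + n * 4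
    rank-letters< (h<t , _ , at-t , _) = rank-letter< (<-trans h<t (at⇒< w _ at-t)) , rank-letter< (at⇒< w _ at-t)
    to : Occ (M w) (linkE h) p → Occ (M (w ∷ʳ x)) (linkE h) p
    to (inj₁ (e , t , l)) = inj₁ (events-∷ʳ-at w x p e , t , proj₂ (same-links t) l)
    to (inj₂ (t , e , l)) = inj₂ (t , events-∷ʳ-at w x p e , proj₂ (same-links t) l)
    from : Occ (M (w ∷ʳ x)) (linkE h) p → Occ (M w) (linkE h) p
    from (inj₁ (e , t , l)) = inj₁ (events-∷ʳ-at⁻ w x p (proj₁ (rank-letters< (proj₂ linked))) e , t , proj₁ (same-links t) l)
    from (inj₂ (t , e , l)) = inj₂ (t , events-∷ʳ-at⁻ w x p (proj₂ (rank-letters< l')) e , l')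
      where l' = proj₁ (same-links t) l
  same : ∀ {k} (y : Item k) → Present (M w) y → ∀ p → Occ (M w) y p iff Occ (M (w ∷ʳ x)) y p
  same rootV = nonLink nl-rootV
  same (childV i) = nonLink (nl-childV i)
  same rootH = nonLink nl-rootH
  same (treeTail i) = nonLink (nl-treeTail i)
  same (treeHead i) = nonLink (nl-treeHead i)
  same (headH j) = nonLink (nl-headH j)
  same (tailH j) = nonLink (nl-tailH j)
  same (treeE i) = nonLink (nl-treeE i)
  same (linkE h) = link h

prefixShuffle⇒noNegative : ∀ {w} → PrefixShuffle w → ∀ F → firstNegative F 0 w ≡ nothing
prefixShuffle⇒noNegative {w} ps A = dominated⇒noNegative A 0 w (proj₁ ∘ ps)
prefixShuffle⇒noNegative {w} ps B = dominated⇒noNegative B 0 w (proj₂ ∘ ps)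

-- The tour of T_w ends by closing the edges of the unmatched letters a, whose number is the height.
contour-M : ∀ w → firstNegative A 0 w ≡ nothing → contour (M w) ≡ steps 0 w ++ replicate (height A 0 w) up
contour-M w nn = cong (λ k → steps 0 w ++ replicate k up)
  (trans (cong (_∸ count ā w) (sym (height-count A 0 w nn))) (m+n∸n≡m (height A 0 w) (count ā w)))

contour-M-∷ʳ : ∀ w x → firstNegative A 0 (w ∷ʳ x) ≡ nothing
  → contour (M (w ∷ʳ x)) ≡ steps 0 w ++ stepOf (length w) x ∷ replicate (raise (role A x) (height A 0 w)) up
contour-M-∷ʳ w x nn = begin
    contour (M (w ∷ʳ x))
  ≡⟨ contour-M (w ∷ʳ x) nn ⟩
    steps 0 (w ∷ʳ x) ++ replicate (height A 0 (w ∷ʳ x)) up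
  ≡⟨ cong₂ (λ s k → s ++ replicate k up) (steps-++ 0 w (x ∷ [])) (height-∷ʳ A 0 w x) ⟩
    (steps 0 w ++ stepOf (length w) x ∷ []) ++ replicate (raise (role A x) (height A 0 w)) up
  ≡⟨ ++-assoc (steps 0 w) _ _ ⟩
    steps 0 w ++ stepOf (length w) x ∷ replicate (raise (role A x) (height A 0 w)) up
  ∎ where open ≡-Reasoning

insertAt-++ : ∀ (xs ys zs : List Step) → insertAt (length xs) ys (xs ++ zs) ≡ xs ++ ys ++ zs
insertAt-++ [] ys zs = refl
insertAt-++ (x ∷ xs) ys zs = cong (x ∷_) (insertAt-++ xs ys zs)

insertAt-contour : ∀ w ys k → insertAt (length w) ys (steps 0 w ++ replicate k up) ≡ steps 0 w ++ ys ++ replicate k up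
insertAt-contour w ys k = subst (λ n → insertAt n ys (steps 0 w ++ replicate k up) ≡ steps 0 w ++ ys ++ replicate k up)
  (length-steps 0 w) (insertAt-++ (steps 0 w) ys (replicate k up))

contour-∷ʳ-insert : ∀ w x ys → firstNegative A 0 w ≡ nothing → role A x ≢ closer
  → stepOf (length w) x ∷ replicate (raise (role A x) (height A 0 w)) up ≡ ys ++ replicate (height A 0 w) up
  → contour (M (w ∷ʳ x)) ≡ insertAt (length w) ys (contour (M w))
contour-∷ʳ-insert w x ys nn not-closer inserted = begin
    contour (M (w ∷ʳ x))
  ≡⟨ contour-M-∷ʳ w x (noNegative-∷ʳ⁻ A 0 w x nn (safe (role A x) not-closer)) ⟩
    steps 0 w ++ stepOf (length w) x ∷ replicate (raise (role A x) (height A 0 w)) up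
  ≡⟨ cong (steps 0 w ++_) inserted ⟩
    steps 0 w ++ ys ++ replicate (height A 0 w) up
  ≡⟨ sym (insertAt-contour w ys _) ⟩
    insertAt (length w) ys (steps 0 w ++ replicate (height A 0 w) up)
  ≡⟨ cong (insertAt (length w) ys) (sym (contour-M w nn)) ⟩
    insertAt (length w) ys (contour (M w))
  ∎
  where
  open ≡-Reasoning
  safe : ∀ r {h} → r ≢ closer → Safe r h
  safe opener _ = tt
  safe closer r≢ = ⊥-elim (r≢ refl)
  safe other _ = tt

steps-split : ∀ w i {x} → w at i ≡ just x → steps 0 w ≡ steps 0 (take i w) ++ stepOf i x ∷ steps (suc i) (drop (suc i) w)
steps-split w i {x} at-i =
  trans (cong (steps 0) (at⇒take-∷-drop w i at-i))
    (trans (steps-++ 0 (take i w) (x ∷ drop (suc i) w))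
      (cong (λ n → steps 0 (take i w) ++ steps n (x ∷ drop (suc i) w)) (length-take-≤ w (<⇒≤ (at⇒< w i at-i)))))

Branch : ℕ → Set
Branch i = (k j : ℕ) → List Step → Dec (j ≡ i) → Maybe ℕ

record MatchUpUnfolding (i : ℕ) (go : ℕ → List Step → Maybe ℕ) (branch : Branch i) : Set where
  field
    start      : ∀ xs → matchUp i xs ≡ go 0 xs
    go-up      : ∀ k xs → go k (up ∷ xs) ≡ go (suc k) xs
    go-hd      : ∀ k h xs → go k (hd h ∷ xs) ≡ go (suc k) xs
    go-tl      : ∀ k t xs → go k (tl t ∷ xs) ≡ go (suc k) xs
    go-down    : ∀ k j xs → go k (down j ∷ xs) ≡ branch k j xs (j ≟ i)
    branch-no  : ∀ k j xs p → branch k j xs (no p) ≡ go (suc k) xs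
    branch-yes : ∀ k j xs p → branch k j xs (yes p) ≡ matchFrom 0 (suc k) xs

-- The local function of matchUp and its `with`-auxiliary cannot be named; they are
-- obtained as solutions of the metavariables below, and abstracting the literal 1 and
-- the decision j ≟ i by `with` turns the equations fixing them into pattern unification problems.
private
  Pinned : (i : ℕ) → (ℕ → List Step → Maybe ℕ) → Branch i → Set
  Pinned i go branch = (j : ℕ) (xs : List Step)
    → (matchUp i (up ∷ xs) ≡ go 1 xs) × (matchUp i (up ∷ down j ∷ xs) ≡ branch 1 j xs (j ≟ i))
    × MatchUpUnfolding i go branch

  pinned : (i : ℕ) → Pinned i _ _
  pinned i j xs with 1 | j ≟ i
  ... | _ | _ = refl , refl , record
    { start = λ _ → refl ; go-up = λ _ _ → refl ; go-hd = λ _ _ _ → refl ; go-tl = λ _ _ _ → refl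
    ; go-down = λ _ _ _ → refl ; branch-no = λ _ _ _ _ → refl ; branch-yes = λ _ _ _ _ → refl }

module _ {i go branch} (U : MatchUpUnfolding i go branch) where
  open MatchUpUnfolding U

  private
    branch-≢ : ∀ k j xs → j ≢ i → branch k j xs (j ≟ i) ≡ go (suc k) xs
    branch-≢ k j xs j≢i with j ≟ i
    ... | yes j≡i = ⊥-elim (j≢i j≡i)
    ... | no j≢i' = branch-no k j xs j≢i'

    go-steps : ∀ k p u L → p + length u ≤ i → go k (steps p u ++ L) ≡ go (k + length u) L
    go-steps k p [] L _ = cong (λ n → go n L) (sym (+-identityʳ k))
    go-steps k p (x ∷ u) L le = trans (skip x) (trans (go-steps (suc k) (suc p) u L le') (cong (λ n → go n L) (sym (+-suc k (length u)))))
      where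
      le' : suc p + length u ≤ i
      le' = subst (_≤ i) (+-suc p (length u)) le
      skip : ∀ x → go k (stepOf p x ∷ steps (suc p) u ++ L) ≡ go (suc k) (steps (suc p) u ++ L)
      skip a = trans (go-down k p _) (branch-≢ k p _ (<⇒≢ (<-≤-trans (s≤s (m≤m+n p (length u))) le')))
      skip ā = go-up k _
      skip b = go-hd k p _
      skip b̄ = go-tl k p _

  matchUp-steps-down : ∀ u rest → length u ≤ i → matchUp i (steps 0 u ++ down i ∷ rest) ≡ matchFrom 0 (suc (length u)) rest
  matchUp-steps-down u rest le = trans (start _) (trans (go-steps 0 0 u (down i ∷ rest) le) (trans (go-down _ i rest) found))
    where
    found : branch (length u) i rest (i ≟ i) ≡ matchFrom 0 (suc (length u)) rest
    found with i ≟ i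
    ... | yes i≡i = branch-yes _ i rest i≡i
    ... | no i≢i = ⊥-elim (i≢i refl)

matchUp-at : ∀ i u rest → length u ≤ i → matchUp i (steps 0 u ++ down i ∷ rest) ≡ matchFrom 0 (suc (length u)) rest
matchUp-at i = matchUp-steps-down (proj₂ (proj₂ (pinned i 0 [])))

matchFrom-steps : ∀ d k p u L → firstNegative A d u ≡ nothing
                → matchFrom d k (steps p u ++ L) ≡ matchFrom (height A d u) (k + length u) L
matchFrom-steps d k p [] L _ = cong (λ n → matchFrom d n L) (sym (+-identityʳ k))
matchFrom-steps d k p (a ∷ u) L nn =
  trans (matchFrom-steps (suc d) (suc k) (suc p) u L (map≡nothing nn)) (cong (λ n → matchFrom (height A (suc d) u) n L) (sym (+-suc k (length u))))
matchFrom-steps (suc d) k p (ā ∷ u) L nn =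
  trans (matchFrom-steps d (suc k) (suc p) u L (map≡nothing nn)) (cong (λ n → matchFrom (height A d u) n L) (sym (+-suc k (length u))))
matchFrom-steps d k p (b ∷ u) L nn =
  trans (matchFrom-steps d (suc k) (suc p) u L (map≡nothing nn)) (cong (λ n → matchFrom (height A d u) n L) (sym (+-suc k (length u))))
matchFrom-steps d k p (b̄ ∷ u) L nn =
  trans (matchFrom-steps d (suc k) (suc p) u L (map≡nothing nn)) (cong (λ n → matchFrom (height A d u) n L) (sym (+-suc k (length u))))

matchUp-lastUnmatched : ∀ w i → firstNegative A 0 w ≡ nothing → LastUnmatched A w i
                      → matchUp i (contour (M w)) ≡ just (length w)
matchUp-lastUnmatched w i nn (u@(at-i , nn-s) , h0) = begin
    matchUp i (contour (M w))
  ≡⟨ cong (matchUp i) (contour-M w nn) ⟩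
    matchUp i (steps 0 w ++ ups)
  ≡⟨ cong (λ z → matchUp i (z ++ ups)) (steps-split w i at-i) ⟩
    matchUp i ((steps 0 (take i w) ++ down i ∷ steps (suc i) s) ++ ups)
  ≡⟨ cong (matchUp i) (++-assoc (steps 0 (take i w)) _ ups) ⟩
    matchUp i (steps 0 (take i w) ++ down i ∷ steps (suc i) s ++ ups)
  ≡⟨ matchUp-at i (take i w) _ (≤-reflexive length-prefix) ⟩
    matchFrom 0 (suc (length (take i w))) (steps (suc i) s ++ ups)
  ≡⟨ matchFrom-steps 0 _ (suc i) s ups nn-s ⟩
    matchFrom (height A 0 s) (suc (length (take i w)) + length s) ups
  ≡⟨ cong₂ (λ h n → matchFrom h (suc n + length s) ups) h0 length-prefix ⟩
    matchFrom 0 (suc i + length s) ups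
  ≡⟨ cong (matchFrom 0 (suc i + length s)) (cong (λ h → replicate h up) (height-unmatched A w i u)) ⟩
    just (suc i + length s)
  ≡⟨ cong just (trans (cong (suc i +_) (length-drop (suc i) w)) (m+[n∸m]≡n (at⇒< w i at-i))) ⟩
    just (length w)
  ∎
  where
  open ≡-Reasoning
  s = drop (suc i) w
  ups = replicate (height A 0 w) up
  length-prefix : length (take i w) ≡ i
  length-prefix = length-take-≤ w (<⇒≤ (at⇒< w i at-i))

activeEdge-of-unmatched : ∀ w j → Unmatched A w j → ActiveEdge (M w) j
activeEdge-of-unmatched w j u = unmatched⇒unpaired A w j u , present-letter w j 1 (nl-treeE j) (proj₁ u) refl

treeHead-injective : ∀ {i j} → treeHead i ≡ treeHead j → i ≡ j
treeHead-injective refl = refl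

rank-cancel : ∀ k {i j} → k + i * 4 < k + j * 4 → i < j
rank-cancel k {i} {j} lt = *-cancelʳ-< 4 i j (+-cancelˡ-< k (i * 4) (j * 4) lt)

corner≡length : ∀ w c → PrefixShuffle w → CornerLeftOfLastRootingHead (M w) c → c ≡ length w
corner≡length w c ps (.rootH , (_ , last) , lc-root) = begin
    length (contour (M w))
  ≡⟨ cong length (contour-M w nn) ⟩
    length (steps 0 w ++ replicate (height A 0 w) up)
  ≡⟨ length-++ (steps 0 w) ⟩
    length (steps 0 w) + length (replicate (height A 0 w) up)
  ≡⟨ cong₂ _+_ (length-steps 0 w) (trans (length-replicate (height A 0 w)) no-pending) ⟩
    length w + 0
  ≡⟨ +-identityʳ (length w) ⟩
    length w
  ∎
  where
  open ≡-Reasoning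
  nn : firstNegative A 0 w ≡ nothing
  nn = prefixShuffle⇒noNegative ps A
  -- an unmatched a would give a rooting head after the root
  no-pending : height A 0 w ≡ 0
  no-pending with height A 0 w in eq
  ... | zero = refl
  ... | suc _ with lastUnmatched-exists A w nn (subst (0 <_) (sym eq) (s≤s z≤n))
  ...   | e , u , _ with before⇒rank< (M w) (ascending-events w) (nl-treeHead e) nl-rootH
                          (last (treeHead e) (inj₂ (e , refl , activeEdge-of-unmatched w e u)) (λ ()))
  ...     | s≤s ()
corner≡length w c ps (.(treeHead _) , (inj₁ () , _) , lc-tree _)
corner≡length w c ps (.(treeHead i) , (inj₂ (_ , refl , active , _) , last) , lc-tree {i} matchUp≡c) =
  just-injective (trans (sym matchUp≡c) (matchUp-lastUnmatched w i nn
    (last-unmatched A w i (unpaired⇒unmatched A w i active) maximal)))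
  where
  nn : firstNegative A 0 w ≡ nothing
  nn = prefixShuffle⇒noNegative ps A
  maximal : ∀ j → Unmatched A w j → j ≤ i
  maximal j u with j ≟ i
  ... | yes refl = ≤-refl
  ... | no j≢i = <⇒≤ (rank-cancel 4 (before⇒rank< (M w) (ascending-events w) (nl-treeHead j) (nl-treeHead i)
                   (last (treeHead j) (inj₂ (j , refl , activeEdge-of-unmatched w j u)) (j≢i ∘ treeHead-injective))))

links-∷ʳ : ∀ w x → x ≢ b̄ → SameLinks (M w) (M (w ∷ʳ x))
links-∷ʳ w x x≢ h t = swap-iff (paired-∷ʳ-other B w x h t x≢)

active-∷ʳ : ∀ w x {i} → x ≢ ā → i ≢ length w → Active (M w) i iff Active (M (w ∷ʳ x)) i
active-∷ʳ w x {i} x≢ i≢n =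
    (λ (at-i , unpaired) → trans (at-∷ʳ-≢ w x i≢n) at-i , λ (j , p) → unpaired (j , proj₁ (paired-∷ʳ-other A w x i j x≢) p))
  , (λ (at-i , unpaired) → trans (sym (at-∷ʳ-≢ w x i≢n)) at-i , λ (j , p) → unpaired (j , proj₂ (paired-∷ʳ-other A w x i j x≢) p))

sameActive-∷ʳ : ∀ w x → x ≢ a → x ≢ ā → SameActive (M w) (M (w ∷ʳ x))
sameActive-∷ʳ w x x≢a x≢ā i with i ≟ length w
... | no i≢n = active-∷ʳ w x x≢ā i≢n
... | yes refl = (λ (at-n , _) → ⊥-elim (<-irrefl refl (at⇒< w _ at-n)))
               , (λ (at-n , _) → ⊥-elim (x≢a (just-injective (trans (sym (at-∷ʳ-length w x)) at-n))))

<-of-∷ʳ : ∀ (w : List Letter) x {i y} → (w ∷ʳ x) at i ≡ just y → i ≢ length w → i < length w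
<-of-∷ʳ w x at-i i≢n = ≤∧≢⇒< (at-∷ʳ⇒≤ w x at-i) i≢n

appending-a : ∀ w → firstNegative A 0 w ≡ nothing
  → ∃[ e ] (¬ Present (M w) (treeE e) × ¬ Present (M w) (childV e)
            × contour (M (w ∷ʳ a)) ≡ insertAt (length w) (down e ∷ up ∷ []) (contour (M w))
            × (∀ i → i ≢ e → Active (M w) i iff Active (M (w ∷ʳ a)) i)
            × SameLinks (M w) (M (w ∷ʳ a))
            × LastActiveEdge (M (w ∷ʳ a)) e
            × SameOrder (M w) (M (w ∷ʳ a)))
appending-a w nn =
  n , fresh w (nl-treeE n) (n≤1+n _) , fresh w (nl-childV n) (m≤n+m _ 3)
    , contour-∷ʳ-insert w a (down n ∷ up ∷ []) nn (λ ()) refl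
    , (λ i i≢n → active-∷ʳ w a (λ ()) i≢n) , links-∷ʳ w a (λ ()) , last-active , sameOrder-∷ʳ w a
  where
  n = length w
  present-n : Present (M (w ∷ʳ a)) (treeE n)
  present-n = present-letter (w ∷ʳ a) n 1 (nl-treeE n) (at-∷ʳ-length w a) refl
  last-active : LastActiveEdge (M (w ∷ʳ a)) n
  last-active = ((at-∷ʳ-length w a , newest-unpaired A w a) , present-n)
    , λ i ((at-i , _) , present-i) i≢n → before-by-rank (M (w ∷ʳ a)) (ascending-events (w ∷ʳ a)) (nl-treeE i) (nl-treeE n)
        present-i present-n (+-monoʳ-< 1 (rank-letter< (<-of-∷ʳ w a at-i i≢n)))

appending-b : ∀ w → firstNegative A 0 w ≡ nothing
  → ∃[ h ] (¬ Present (M w) (headH h)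
            × contour (M (w ∷ʳ b)) ≡ insertAt (length w) (hd h ∷ []) (contour (M w))
            × SameActive (M w) (M (w ∷ʳ b))
            × SameLinks (M w) (M (w ∷ʳ b))
            × LastDangling (M (w ∷ʳ b)) h
            × SameOrder (M w) (M (w ∷ʳ b)))
appending-b w nn =
  n , fresh w (nl-headH n) ≤-refl , contour-∷ʳ-insert w b (hd n ∷ []) nn (λ ()) refl
    , sameActive-∷ʳ w b (λ ()) (λ ()) , links-∷ʳ w b (λ ()) , last-dangling , sameOrder-∷ʳ w b
  where
  n = length w
  present-n : Present (M (w ∷ʳ b)) (headH n)
  present-n = present-letter (w ∷ʳ b) n 0 (nl-headH n) (at-∷ʳ-length w b) refl
  last-dangling : LastDangling (M (w ∷ʳ b)) n
  last-dangling = (present-n , newest-unpaired B w b)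
    , λ h ((p , o) , _) h≢n → before-by-rank (M (w ∷ʳ b)) (ascending-events (w ∷ʳ b)) (nl-headH h) (nl-headH n)
        (p , o) present-n (rank-letter< (<-of-∷ʳ w b (event-headH (w ∷ʳ b) p o) h≢n))

walk-++ : ∀ xs ys st → walk (xs ++ ys) st ≡ walk ys (walk xs st)
walk-++ [] ys st = refl
walk-++ (down i ∷ xs) ys st = walk-++ xs ys _
walk-++ (up ∷ xs) ys st = walk-++ xs ys _
walk-++ (hd _ ∷ xs) ys st = walk-++ xs ys _
walk-++ (tl _ ∷ xs) ys st = walk-++ xs ys _

pop-++ : ∀ z (Z : List (Item vK)) v S → pop (z ∷ Z ++ v ∷ S) ≡ Z ++ v ∷ S
pop-++ z [] v S = refl
pop-++ z (_ ∷ Z) v S = refl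

-- Above v, the stack holds the end vertices of the edges of T_w that are still open.
walk-steps : ∀ d p u (Z₀ : List (Item vK)) v S → firstNegative A d u ≡ nothing → length Z₀ ≡ d
           → ∃[ Z ] (walk (steps p u) (Z₀ ++ v ∷ S) ≡ Z ++ v ∷ S × length Z ≡ height A d u)
walk-steps d p [] Z₀ v S _ len = Z₀ , refl , len
walk-steps d p (a ∷ u) Z₀ v S nn len = walk-steps (suc d) (suc p) u (childV p ∷ Z₀) v S (map≡nothing nn) (cong suc len)
walk-steps zero p (ā ∷ u) Z₀ v S () len
walk-steps (suc d) p (ā ∷ u) [] v S nn ()
walk-steps (suc d) p (ā ∷ u) (z ∷ Z₀) v S nn len with walk-steps d (suc p) u Z₀ v S (map≡nothing nn) (suc-injective len)
... | Z , eq , lenZ = Z , trans (cong (walk (steps (suc p) u)) (pop-++ z Z₀ v S)) eq , lenZ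
walk-steps d p (b ∷ u) Z₀ v S nn len = walk-steps d (suc p) u Z₀ v S (map≡nothing nn) len
walk-steps d p (b̄ ∷ u) Z₀ v S nn len = walk-steps d (suc p) u Z₀ v S (map≡nothing nn) len

top-walk-balanced : ∀ p u v S → Balanced A u → top (walk (steps p u) (v ∷ S)) ≡ v
top-walk-balanced p u v S (nn , h0) with walk-steps 0 p u [] v S nn refl
... | [] , eq , _ = cong top eq
... | _ ∷ _ , _ , len = ⊥-elim (1+n≢0 (trans len h0))

corner-at-letter : ∀ w e {x} → w at e ≡ just x
                 → cornerVertex (contour (M w)) e ≡ top (walk (steps 0 (take e w)) (rootV ∷ []))
corner-at-letter w e {x} at-e = cong (λ xs → top (walk xs (rootV ∷ []))) prefix
  where
  open ≡-Reasoning
  ups = replicate (count a w ∸ count ā w) up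
  rest = stepOf e x ∷ steps (suc e) (drop (suc e) w)
  length-prefix : length (steps 0 (take e w)) ≡ e
  length-prefix = trans (length-steps 0 (take e w)) (length-take-≤ w (<⇒≤ (at⇒< w e at-e)))
  prefix : take e (contour (M w)) ≡ steps 0 (take e w)
  prefix = begin
      take e (steps 0 w ++ ups)
    ≡⟨ cong (λ s → take e (s ++ ups)) (steps-split w e at-e) ⟩
      take e ((steps 0 (take e w) ++ rest) ++ ups)
    ≡⟨ cong (take e) (++-assoc (steps 0 (take e w)) rest ups) ⟩
      take e (steps 0 (take e w) ++ rest ++ ups)
    ≡⟨ cong (λ k → take k (steps 0 (take e w) ++ rest ++ ups)) (sym length-prefix) ⟩
      take (length (steps 0 (take e w))) (steps 0 (take e w) ++ rest ++ ups)
    ≡⟨ take-++-length (steps 0 (take e w)) _ ⟩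
      steps 0 (take e w)
    ∎

steps-at-down : ∀ p u s {e} → steps p u at s ≡ just (down e) → p + s ≡ e
steps-at-down p (a ∷ u) zero refl = +-identityʳ p
steps-at-down p (ā ∷ u) zero ()
steps-at-down p (b ∷ u) zero ()
steps-at-down p (b̄ ∷ u) zero ()
steps-at-down p (x ∷ u) (suc s) e = trans (+-suc p s) (steps-at-down (suc p) u s e)

ups-at : ∀ k s {st} → replicate k up at s ≡ just st → st ≡ up
ups-at (suc k) zero refl = refl
ups-at (suc k) (suc s) e = ups-at k s e

origin-position : ∀ w e {s} → contour (M w) at s ≡ just (down e) → s ≡ e
origin-position w e {s} at-s with at-++⁻ (steps 0 w) _ s at-s
... | inj₁ at-s' = steps-at-down 0 w s at-s'
... | inj₂ (_ , at-s') with ups-at (count a w ∸ count ā w) (s ∸ length (steps 0 w)) at-s'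
...   | ()

-- q is the unmatched a preceding e: the letters strictly between them are balanced.
origin-of-last : ∀ w e → firstNegative A 0 w ≡ nothing → LastUnmatched A w e
  → (height A 0 (take e w) ≡ 0 × cornerVertex (contour (M w)) e ≡ rootV)
  ⊎ ∃[ q ] (Unmatched A w q × q < e × Balanced A (drop (suc q) (take e w)) × cornerVertex (contour (M w)) e ≡ childV q)
origin-of-last w e nn last@(u-e@(at-e , _) , h0) = cases (height A 0 (take e w)) refl
  where
  T = take e w
  nn-T : firstNegative A 0 T ≡ nothing
  nn-T = firstNegative-++⁻ A 0 T (drop e w) (trans (cong (firstNegative A 0) (take++drop≡id e w)) nn)
  corner-T : cornerVertex (contour (M w)) e ≡ top (walk (steps 0 T) (rootV ∷ []))
  corner-T = corner-at-letter w e at-e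
  cases : ∀ h → height A 0 T ≡ h
        → (height A 0 T ≡ 0 × cornerVertex (contour (M w)) e ≡ rootV)
        ⊎ ∃[ q ] (Unmatched A w q × q < e × Balanced A (drop (suc q) T) × cornerVertex (contour (M w)) e ≡ childV q)
  cases zero h-T = inj₁ (h-T , trans corner-T (top-walk-balanced 0 T rootV [] (nn-T , h-T)))
  cases (suc m) h-T = inj₂ (q , u-q , q<e , balanced , corner)
    where
    two-pending : 0 + 1 < height A 0 w
    two-pending = subst (1 <_) (sym (height-unmatched A w e u-e))
      (s≤s (subst (λ h → 1 ≤ h + height A 0 (drop (suc e) w)) (sym h-T) (s≤s z≤n)))
    found : ∃[ q ] (Unmatched A w q × height A 0 (drop (suc q) w) ≡ 1)
    found = unmatched-of-height A 0 (reverseView w) 1 nn two-pending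
    q : ℕ
    q = proj₁ found
    u-q : Unmatched A w q
    u-q = proj₁ (proj₂ found)
    q<e : q < e
    q<e = unmatched-before-last A w e q last u-q (λ q≡e → 1+n≢0 (trans (sym (proj₂ (proj₂ found)))
            (trans (cong (λ k → height A 0 (drop (suc k) w)) q≡e) h0)))
    r = e ∸ suc q
    tq = drop (suc q) w
    u-r : Unmatched A tq r
    u-r = proj₂ (unmatched-drop A w q r) (subst (Unmatched A w) (sym (m+[n∸m]≡n q<e)) u-e)
    mid≡ : drop (suc q) T ≡ take r tq
    mid≡ = trans (cong (λ k → drop (suc q) (take k w)) (sym (m+[n∸m]≡n q<e))) (sym (take-drop r (suc q) w))
    balanced : Balanced A (drop (suc q) T)
    balanced = subst (Balanced A) (sym mid≡)
      ( firstNegative-++⁻ A 0 (take r tq) (drop r tq) (trans (cong (firstNegative A 0) (take++drop≡id r tq)) (proj₂ u-q))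
      , m+n≡0⇒m≡0 _ (suc-injective (trans (sym (height-unmatched A tq r u-r)) (proj₂ (proj₂ found)))))
    corner : cornerVertex (contour (M w)) e ≡ childV q
    corner = trans corner-T (trans (cong (λ s → top (walk s (rootV ∷ []))) (steps-split T q (trans (at-take w q<e) (proj₁ u-q))))
      (trans (cong top (walk-++ (steps 0 (take q T)) _ _)) (top-walk-balanced (suc q) (drop (suc q) T) (childV q) _ balanced)))

module Appending-ā (w : List Letter) (ps : PrefixShuffle w) (ps' : PrefixShuffle (w ∷ʳ ā)) where

  private
    n = length w
    nn : firstNegative A 0 w ≡ nothing
    nn = prefixShuffle⇒noNegative ps A
    safe : Safe closer (height A 0 w)
    safe = proj₂ (noNegative-∷ʳ A 0 w ā (prefixShuffle⇒noNegative ps' A))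
    found : ∃[ e ] LastUnmatched A w e
    found = lastUnmatched-exists A w nn (safe-closer⇒0< safe)

  e : ℕ
  e = proj₁ found

  last : LastUnmatched A w e
  last = proj₂ found

  edge-e : ActiveEdge (M w) e
  edge-e = activeEdge-of-unmatched w e (proj₁ last)

  last-active : LastActiveEdge (M w) e
  last-active = edge-e , λ i (active-i , present-i) i≢e →
    before-by-rank (M w) (ascending-events w) (nl-treeE i) (nl-treeE e) present-i (proj₂ edge-e)
      (+-monoʳ-< 1 (rank-letter< (unmatched-before-last A w e i last (unpaired⇒unmatched A w i active-i) i≢e)))

  contour-same : contour (M (w ∷ʳ ā)) ≡ contour (M w)
  contour-same = trans (contour-M-∷ʳ w ā (prefixShuffle⇒noNegative ps' A))
    (trans (cong (steps 0 w ++_) (ups-pred (height A 0 w) safe)) (sym (contour-M w nn)))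
    where
    ups-pred : ∀ h → Safe closer h → up ∷ replicate (pred h) up ≡ replicate h up
    ups-pred (suc h) _ = refl

  active-iff : ∀ i → Active (M (w ∷ʳ ā)) i iff (Active (M w) i × i ≢ e)
  active-iff i = to , from
    where
    to : Active (M (w ∷ʳ ā)) i → Active (M w) i × i ≢ e
    to (at-i , unpaired) = (trans (sym (at-∷ʳ-≢ w ā i≢n)) at-i , λ (j , p) → unpaired (j , paired-∷ʳ⁻ A w ā i j (inj₁ p)))
                         , λ i≡e → unpaired (n , paired-∷ʳ⁻ A w ā i n (inj₂ (refl , refl , subst (LastUnmatched A w) (sym i≡e) last)))
      where
      i≢n : i ≢ n
      i≢n i≡n with trans (sym at-i) (trans (cong ((w ∷ʳ ā) at_) i≡n) (at-∷ʳ-length w ā))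
      ... | ()
    from : Active (M w) i × i ≢ e → Active (M (w ∷ʳ ā)) i
    from ((at-i , unpaired) , i≢e) = trans (at-∷ʳ-≢ w ā (<⇒≢ (at⇒< w i at-i))) at-i
      , λ (j , p) → [ (λ p' → unpaired (j , p')) , (λ (_ , _ , last-i) → i≢e (lastUnmatched-unique A w i e last-i last)) ]′
                      (paired-∷ʳ A w ā i j p)

  active-after : ∀ i → Active (M (w ∷ʳ ā)) i → Unmatched A w i × i < e
  active-after i act =
    let active-w , i≢e = proj₁ (active-iff i) act
        u = unpaired⇒unmatched A w i active-w
    in u , unmatched-before-last A w e i last u i≢e

  present-child : ∀ i → (w ∷ʳ ā) at i ≡ just a → Present (M (w ∷ʳ ā)) (childV i)
  present-child i at-i = present-letter (w ∷ʳ ā) i 3 (nl-childV i) at-i refl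

  root-last : height A 0 (take e w) ≡ 0 → LastRootingVertex (M (w ∷ʳ ā)) rootV
  root-last h-T = (rootH , inj₁ refl , end-root) , others
    where
    others : ∀ u → RootingVertex (M (w ∷ʳ ā)) u → u ≢ rootV → Before (M (w ∷ʳ ā)) u rootV
    others .rootV (.rootH , _ , end-root) u≢ = ⊥-elim (u≢ refl)
    others .(childV _) (.(treeHead _) , inj₁ () , end-tree)
    others .(childV i) (.(treeHead i) , inj₂ (_ , refl , act , _) , end-tree {i}) _ =
      let u , i<e = active-after i act in
      ⊥-elim (height≡0⇒¬unmatched A (take e w) i h-T (unmatched-take A w i<e u))

  child-last : ∀ q → Unmatched A w q → q < e → Balanced A (drop (suc q) (take e w))
             → LastRootingVertex (M (w ∷ʳ ā)) (childV q)
  child-last q u-q q<e (_ , h-mid) = (treeHead q , inj₂ (q , refl , active-q , present-q) , end-tree) , others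
    where
    at-q : (w ∷ʳ ā) at q ≡ just a
    at-q = trans (at-++ˡ w (ā ∷ []) (at⇒< w q (proj₁ u-q))) (proj₁ u-q)
    active-q : Active (M (w ∷ʳ ā)) q
    active-q = proj₂ (active-iff q) (unmatched⇒unpaired A w q u-q , <⇒≢ q<e)
    present-q : Present (M (w ∷ʳ ā)) (treeE q)
    present-q = present-letter (w ∷ʳ ā) q 1 (nl-treeE q) at-q refl
    others : ∀ u → RootingVertex (M (w ∷ʳ ā)) u → u ≢ childV q → Before (M (w ∷ʳ ā)) u (childV q)
    others .rootV (.rootH , _ , end-root) _ =
      before-by-rank (M (w ∷ʳ ā)) (ascending-events (w ∷ʳ ā)) nl-rootV (nl-childV q) (0 , refl) (present-child q at-q) (s≤s z≤n)
    others .(childV _) (.(treeHead _) , inj₁ () , end-tree)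
    others .(childV i) (.(treeHead i) , inj₂ (_ , refl , act , _) , end-tree {i}) u≢ =
      before-by-rank (M (w ∷ʳ ā)) (ascending-events (w ∷ʳ ā)) (nl-childV i) (nl-childV q)
        (present-child i (proj₁ act)) (present-child q at-q) (+-monoʳ-< 3 (rank-letter< i<q))
      where
      i<q : i < q
      i<q with active-after i act | <-cmp i q
      ... | _ | tri< i<q _ _ = i<q
      ... | _ | tri≈ _ i≡q _ = ⊥-elim (u≢ (cong childV i≡q))
      ... | u , i<e | tri> _ _ q<i =
        ⊥-elim (height≡0⇒¬unmatched A (drop (suc q) (take e w)) (i ∸ suc q) h-mid (unmatched-inside A w q<i i<e u))

  last-rooting : ∀ v → Origin (M w) e v → LastRootingVertex (M (w ∷ʳ ā)) v
  last-rooting v (s , at-s , corner-s) with origin-position w e at-s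
  ... | refl with origin-of-last w e nn last
  ...   | inj₁ (h-T , corner) = subst (LastRootingVertex (M (w ∷ʳ ā))) (trans (sym corner) corner-s) (root-last h-T)
  ...   | inj₂ (q , u-q , q<e , bal , corner) =
    subst (LastRootingVertex (M (w ∷ʳ ā))) (trans (sym corner) corner-s) (child-last q u-q q<e bal)

appending-ā : ∀ w → PrefixShuffle w → PrefixShuffle (w ∷ʳ ā)
  → ∃[ e ] (LastActiveEdge (M w) e
            × contour (M (w ∷ʳ ā)) ≡ contour (M w)
            × (∀ i → Active (M (w ∷ʳ ā)) i iff (Active (M w) i × i ≢ e))
            × SameLinks (M w) (M (w ∷ʳ ā))
            × (∀ v → Origin (M w) e v → LastRootingVertex (M (w ∷ʳ ā)) v)
            × SameOrder (M w) (M (w ∷ʳ ā)))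
appending-ā w ps ps' = e , last-active , contour-same , active-iff , links-∷ʳ w ā (λ ()) , last-rooting , sameOrder-∷ʳ w ā
  where open Appending-ā w ps ps'

appending-b̄ : ∀ w → PrefixShuffle w → PrefixShuffle (w ∷ʳ b̄)
  → ∃[ h ] ∃[ t ] (LastDangling (M w) h
            × ¬ Present (M w) (tailH t)
            × contour (M (w ∷ʳ b̄)) ≡ insertAt (length w) (tl t ∷ []) (contour (M w))
            × SameActive (M w) (M (w ∷ʳ b̄))
            × (∀ h' t' → Link (M (w ∷ʳ b̄)) h' t' iff (Link (M w) h' t' ⊎ (h' ≡ h × t' ≡ t)))
            × SameOrder (M w) (M (w ∷ʳ b̄)))
appending-b̄ w ps ps' =
  h , n , last-dangling , fresh w (nl-tailH n) ≤-refl
    , contour-∷ʳ-insert w b̄ (tl n ∷ []) (prefixShuffle⇒noNegative ps A) (λ ()) refl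
    , sameActive-∷ʳ w b̄ (λ ()) (λ ()) , link-iff , sameOrder-∷ʳ w b̄
  where
  n = length w
  nn : firstNegative B 0 w ≡ nothing
  nn = prefixShuffle⇒noNegative ps B
  found : ∃[ h ] LastUnmatched B w h
  found = lastUnmatched-exists B w nn (safe-closer⇒0< (proj₂ (noNegative-∷ʳ B 0 w b̄ (prefixShuffle⇒noNegative ps' B))))
  h : ℕ
  h = proj₁ found
  last : LastUnmatched B w h
  last = proj₂ found
  present-h : Present (M w) (headH h)
  present-h = present-letter w h 0 (nl-headH h) (proj₁ (proj₁ last)) refl

  last-dangling : LastDangling (M w) h
  last-dangling = (present-h , proj₂ (unmatched⇒unpaired B w h (proj₁ last)))
    , λ h' ((p , o) , unlinked) h'≢h → before-by-rank (M w) (ascending-events w) (nl-headH h') (nl-headH h) (p , o) present-h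
        (rank-letter< (unmatched-before-last B w h h' last (unpaired⇒unmatched B w h' (event-headH w p o , unlinked)) h'≢h))

  link-iff : ∀ h' t' → Link (M (w ∷ʳ b̄)) h' t' iff (Link (M w) h' t' ⊎ (h' ≡ h × t' ≡ n))
  link-iff h' t' = to , from
    where
    to : Paired B (w ∷ʳ b̄) h' t' → Paired B w h' t' ⊎ (h' ≡ h × t' ≡ n)
    to p = [ inj₁ , (λ (t'≡n , _ , last') → inj₂ (lastUnmatched-unique B w h' h last' last , t'≡n)) ]′ (paired-∷ʳ B w b̄ h' t' p)
    from : Paired B w h' t' ⊎ (h' ≡ h × t' ≡ n) → Paired B (w ∷ʳ b̄) h' t'
    from (inj₁ p) = paired-∷ʳ⁻ B w b̄ h' t' (inj₁ p)
    from (inj₂ (refl , refl)) = paired-∷ʳ⁻ B w b̄ h n (inj₂ (refl , refl , last))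

lemma8 : (w : List Letter) → PrefixShuffle w
    → (c : ℕ) → CornerLeftOfLastRootingHead (M w) c
    → (∃[ e ] (¬ Present (M w) (treeE e) × ¬ Present (M w) (childV e)
               × contour (M (w ∷ʳ a)) ≡ insertAt c (down e ∷ up ∷ []) (contour (M w))
               × (∀ i → i ≢ e → Active (M w) i iff Active (M (w ∷ʳ a)) i)
               × SameLinks (M w) (M (w ∷ʳ a))
               × LastActiveEdge (M (w ∷ʳ a)) e
               × SameOrder (M w) (M (w ∷ʳ a))))
    × (∃[ h ] (¬ Present (M w) (headH h)
               × contour (M (w ∷ʳ b)) ≡ insertAt c (hd h ∷ []) (contour (M w))
               × SameActive (M w) (M (w ∷ʳ b))
               × SameLinks (M w) (M (w ∷ʳ b))
               × LastDangling (M (w ∷ʳ b)) h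
               × SameOrder (M w) (M (w ∷ʳ b))))
    × (PrefixShuffle (w ∷ʳ ā)
       → ∃[ e ] (LastActiveEdge (M w) e
               × contour (M (w ∷ʳ ā)) ≡ contour (M w)
               × (∀ i → Active (M (w ∷ʳ ā)) i iff (Active (M w) i × i ≢ e))
               × SameLinks (M w) (M (w ∷ʳ ā))
               × (∀ v → Origin (M w) e v → LastRootingVertex (M (w ∷ʳ ā)) v)
               × SameOrder (M w) (M (w ∷ʳ ā))))
    × (PrefixShuffle (w ∷ʳ b̄)
       → ∃[ h ] ∃[ t ] (LastDangling (M w) h
               × ¬ Present (M w) (tailH t)
               × contour (M (w ∷ʳ b̄)) ≡ insertAt c (tl t ∷ []) (contour (M w))
               × SameActive (M w) (M (w ∷ʳ b̄))
               × (∀ h' t' → Link (M (w ∷ʳ b̄)) h' t' iff (Link (M w) h' t' ⊎ (h' ≡ h × t' ≡ t)))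
               × SameOrder (M w) (M (w ∷ʳ b̄))))
lemma8 w ps c corner with corner≡length w c ps corner
... | refl = appending-a w nn , appending-b w nn , appending-ā w ps , appending-b̄ w ps
  where
  nn : firstNegative A 0 w ≡ nothing
  nn = prefixShuffle⇒noNegative ps A
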